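{- Let $p_2>3$ be a prime with $p_2\equiv 2\pmod 3$, let $p_3>3p_2$ be a prime with $p_3\equiv 2\pmod{3p_2}$, let $q_2=(p_2-2)/3$ and $q=\lfloor p_3/(3p_2)\rfloor$. Let $i=3u+v<p_2-1$ with $u\ge0$ an integer and $v\in\{1,2\}$. Then \[\mathrm{hw}(f_{3p_2,p_3,i,q})=\begin{cases}1, & \text{if } 0\le u\le \frac{q_2-3}{2},\\ v, & \text{if } u\ge \frac{q_2-1}{2}.\end{cases}\]
   Context: $\Phi_n$ is the $n$-th cyclotomic polynomial; $\mathrm{hw}(f)$ is the number of nonzero coefficients of a polynomial $f$. With $m=3p_2$, write $\Phi_{mp_3}(x)=\sum_{i\ge0}f_{m,p_3,i}(x)x^{ip_3}$ with $\deg f_{m,p_3,i}<p_3$, and $f_{m,p_3,i}(x)=\sum_{j\ge0}f_{m,p_3,i,j}(x)x^{jm}$ with $\deg f_{m,p_3,i,j}<m$ (uniquely determined). -}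

module Defs where

open import Data.Nat as ℕ using (ℕ; zero; suc; _≤?_; _<?_)
open import Data.Nat.Divisibility using (_∣?_)
open import Data.Integer as ℤ using (ℤ; +_)
open import Data.List using (List; []; _∷_; _++_; replicate; foldr; filter; length; upTo; map)
open import Relation.Nullary using (yes; no; ¬_)
open import Relation.Nullary.Decidable using (_×-dec_; ¬?)
open import Relation.Binary.PropositionalEquality using (_≡_)

-- Integer polynomials as little-endian coefficient lists
-- (index k = coefficient of x^k; trailing zeros allowed and harmless).
Poly : Set
Poly = List ℤ

coeff : Poly → ℕ → ℤ
coeff []       _       = + 0
coeff (a ∷ _)  zero    = a
coeff (_ ∷ p)  (suc k) = coeff p k

infixl 6 _+ₚ_ _-ₚ_
infixl 7 _*ₚ_ _·ₚ_

_+ₚ_ : Poly → Poly → Poly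
[]      +ₚ q       = q
(a ∷ p) +ₚ []      = a ∷ p
(a ∷ p) +ₚ (b ∷ q) = (a ℤ.+ b) ∷ (p +ₚ q)

_·ₚ_ : ℤ → Poly → Poly
c ·ₚ p = map (c ℤ.*_) p

_-ₚ_ : Poly → Poly → Poly
p -ₚ q = p +ₚ (ℤ.-[1+ 0 ] ·ₚ q)

_*ₚ_ : Poly → Poly → Poly
[]      *ₚ q = []
(a ∷ p) *ₚ q = (a ·ₚ q) +ₚ (+ 0 ∷ (p *ₚ q))

oneₚ : Poly
oneₚ = + 1 ∷ []

xⁿ-1 : ℕ → Poly
xⁿ-1 zero    = []
xⁿ-1 (suc n) = ℤ.-[1+ 0 ] ∷ (replicate n (+ 0) ++ (+ 1 ∷ []))

headℤ : Poly → ℤ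
headℤ []      = + 0
headℤ (a ∷ _) = a

tailₚ : Poly → Poly
tailₚ []      = []
tailₚ (_ ∷ p) = p

-- First N coefficients of the power series a/b, for b with constant
-- term ±1 (so that b₀⁻¹ = b₀).  When b divides a exactly and N ≥ deg a + 1,
-- this is exactly the polynomial quotient a/b.
serDiv : ℕ → Poly → Poly → Poly
serDiv zero    a b = []
serDiv (suc N) a b = c ∷ serDiv N (tailₚ (a -ₚ (c ·ₚ b))) b
  where c = headℤ a ℤ.* headℤ b

prodProperDivs : (ℕ → Poly) → ℕ → Poly
prodProperDivs f m =
  foldr (λ d acc → f d *ₚ acc) oneₚ
        (filter (λ d → (1 ≤? d) ×-dec (d ∣? m)) (upTo m))

newΦ : ℕ → (ℕ → Poly) → Poly
newΦ m f = serDiv (suc m) (xⁿ-1 m) (prodProperDivs f m)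

-- cycTable n k = Φ_k for 1 ≤ k ≤ n  (the value at k = 0 is an unused dummy)
cycTable : ℕ → ℕ → Poly
cycTable zero    k = oneₚ
cycTable (suc n) k with k ≤? n
... | yes _ = cycTable n k
... | no  _ = newΦ (suc n) (cycTable n)

Φ : ℕ → Poly
Φ n = cycTable n n

hw : Poly → ℕ
hw p = length (filter (λ a → ¬? (a ℤ.≟ + 0)) p)

block : Poly → ℕ → ℕ → Poly
block p s L = map (λ k → coeff p (s ℕ.+ k)) (upTo L)

-- f_{m,p₃,i} : Φ_{m p₃} = Σ_i f_{m,p₃,i}(x) x^{i p₃}, deg f_{m,p₃,i} < p₃
f₃ : ℕ → ℕ → ℕ → Poly
f₃ m p₃ i = block (Φ (m ℕ.* p₃)) (i ℕ.* p₃) p₃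

-- f_{m,p₃,i,j} : f_{m,p₃,i} = Σ_j f_{m,p₃,i,j}(x) x^{j m}, deg f_{m,p₃,i,j} < m
f₄ : ℕ → ℕ → ℕ → ℕ → Poly
f₄ m p₃ i j = block (f₃ m p₃ i) (j ℕ.* m) m

-- ℕ floor division / remainder, total (value at divisor 0 is a dummy 0 / m;
-- only used with positive divisors)
divℕ : ℕ → ℕ → ℕ
divℕ m zero    = 0
divℕ m (suc n) = m ℕ./ suc n

modℕ : ℕ → ℕ → ℕ
modℕ m zero    = m
modℕ m (suc n) = m ℕ.% suc n

module Submission where

-- Modulo x^(p₂p₃) only the divisors d < p₂p₃ of n = 3p₂p₃ contribute to ∏_{d ∣ n} Φ_d = xⁿ - 1.
-- Using Φ_p = 1 + x + ⋯ + x^(p-1), Φ_{3p} = (1 - x)(1 - x^(3p)) / ((1 - x³)(1 - x^p)) for p ≡ 2 (mod 3),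
-- and (1 - x)Φ_p Φ_q Φ_{pq} ≡ 1 (mod x^(pq)), this leaves
--   (1 - x^(3p₃)) Φ_n ≡ (1 - x^p₃) H   (mod x^(p₂p₃)),
-- where H is the extension with period 3p₂ of G = (1 + x + x²)(1 - x^p₂).  As p₃ = 3p₂q + 2, the
-- coefficients c_i of Φ_n at i p₃ + 3p₂q + r (r = 0, 1) then satisfy
--   (1 - x³) Σ c_i xⁱ ≡ (1 - x) Σ G(2i + r) xⁱ   (mod x^p₂),
-- so Σ c_i xⁱ is (1 - x)/(1 - x³) times an explicit polynomial once p₂ = 6w + 5 is written out.
-- These two coefficients are the only ones of f_{3p₂,p₃,i,q} that can be nonzero, since f_{3p₂,p₃,i}
-- has degree < p₃ = 3p₂q + 2.

open import Data.Nat as ℕ using (ℕ)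
open import Algebra.Bundles using (CommutativeMonoid)

module PowerSeries where

  open import Data.Nat using (zero; suc; _≤_; _<_; z≤n; s≤s)
  import Data.Nat.Properties as ℕ
  open import Data.Integer using (ℤ; +_; -_; _+_; _*_)
  import Data.Integer.Properties as ℤ
  open import Data.Integer.Tactic.RingSolver using (solve-∀)
  open import Data.Sum using (inj₁; inj₂)
  open import Data.Product using (_,_)
  open import Function using (_∘_)
  open import Level using (0ℓ)
  open import Algebra.Bundles using (CommutativeMonoid)
  open import Relation.Binary.PropositionalEquality

  Series : Set
  Series = ℕ → ℤ

  infixl 6 _+ˢ_
  infixl 7 _*ˢ_
  infix 8 -ˢ_
  infix 4 _≈[_]_

  _+ˢ_ : Series → Series → Series
  (f +ˢ g) k = f k + g k

  -ˢ_ : Series → Series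
  (-ˢ f) k = - f k

  0ˢ 1ˢ : Series
  0ˢ _ = + 0
  1ˢ zero    = + 1
  1ˢ (suc _) = + 0

  _*ˢ_ : Series → Series → Series
  (f *ˢ g) zero    = f 0 * g 0
  (f *ˢ g) (suc k) = f 0 * g (suc k) + (f ∘ suc *ˢ g) k

  shift : ℕ → Series → Series
  shift zero    f k       = f k
  shift (suc a) f zero    = + 0
  shift (suc a) f (suc k) = shift a f k

  x^_ : ℕ → Series
  x^ a = shift a 1ˢ

  1-x^_ : ℕ → Series
  1-x^ a = 1ˢ +ˢ -ˢ x^ a

  _≈[_]_ : Series → ℕ → Series → Set
  f ≈[ L ] g = ∀ k → k < L → f k ≡ g k

  *ˢ-causalˡ : ∀ {f f′} g k → (∀ j → j ≤ k → f j ≡ f′ j) → (f *ˢ g) k ≡ (f′ *ˢ g) k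
  *ˢ-causalˡ g zero    f≈f′ = cong (_* g 0) (f≈f′ 0 z≤n)
  *ˢ-causalˡ g (suc k) f≈f′ =
    cong₂ _+_ (cong (_* g (suc k)) (f≈f′ 0 z≤n)) (*ˢ-causalˡ g k (λ j j≤k → f≈f′ (suc j) (s≤s j≤k)))

  *ˢ-congˡ : ∀ {f f′} g → f ≗ f′ → f *ˢ g ≗ f′ *ˢ g
  *ˢ-congˡ g f≗f′ k = *ˢ-causalˡ g k (λ j _ → f≗f′ j)

  *ˢ-zeroˡ : ∀ g → 0ˢ *ˢ g ≗ 0ˢ
  *ˢ-zeroˡ g zero    = refl
  *ˢ-zeroˡ g (suc k) = cong (_+_ (+ 0)) (*ˢ-zeroˡ g k)

  *ˢ-identityˡ : ∀ g → 1ˢ *ˢ g ≗ g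
  *ˢ-identityˡ g zero    = ℤ.*-identityˡ (g 0)
  *ˢ-identityˡ g (suc k) =
    trans (cong₂ _+_ (ℤ.*-identityˡ (g (suc k))) (*ˢ-zeroˡ g k)) (ℤ.+-identityʳ (g (suc k)))

  *ˢ-distribʳ : ∀ f f′ g → (f +ˢ f′) *ˢ g ≗ f *ˢ g +ˢ f′ *ˢ g
  *ˢ-distribʳ f f′ g zero    = ℤ.*-distribʳ-+ (g 0) (f 0) (f′ 0)
  *ˢ-distribʳ f f′ g (suc k) =
    trans (cong₂ _+_ (ℤ.*-distribʳ-+ (g (suc k)) (f 0) (f′ 0)) (*ˢ-distribʳ (f ∘ suc) (f′ ∘ suc) g k))
          (interchange (f 0 * g (suc k)) (f′ 0 * g (suc k)) ((f ∘ suc *ˢ g) k) ((f′ ∘ suc *ˢ g) k))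
    where
    interchange : ∀ a b c d → (a + b) + (c + d) ≡ (a + c) + (b + d)
    interchange = solve-∀

  *ˢ-negˡ : ∀ f g → (-ˢ f) *ˢ g ≗ -ˢ (f *ˢ g)
  *ˢ-negˡ f g zero    = sym (ℤ.neg-distribˡ-* (f 0) (g 0))
  *ˢ-negˡ f g (suc k) =
    trans (cong₂ _+_ (sym (ℤ.neg-distribˡ-* (f 0) (g (suc k)))) (*ˢ-negˡ (f ∘ suc) g k))
          (sym (ℤ.neg-distrib-+ (f 0 * g (suc k)) ((f ∘ suc *ˢ g) k)))

  *ˢ-scaleˡ : ∀ c f g → (λ k → c * f k) *ˢ g ≗ λ k → c * (f *ˢ g) k
  *ˢ-scaleˡ c f g zero    = ℤ.*-assoc c (f 0) (g 0)
  *ˢ-scaleˡ c f g (suc k) =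
    trans (cong₂ _+_ (ℤ.*-assoc c (f 0) (g (suc k))) (*ˢ-scaleˡ c (f ∘ suc) g k))
          (sym (ℤ.*-distribˡ-+ c (f 0 * g (suc k)) ((f ∘ suc *ˢ g) k)))

  *ˢ-unfoldʳ : ∀ f g k → (f *ˢ g) (suc k) ≡ (f *ˢ (g ∘ suc)) k + f (suc k) * g 0
  *ˢ-unfoldʳ f g zero    = refl
  *ˢ-unfoldʳ f g (suc k) =
    trans (cong (_+_ (f 0 * g (suc (suc k)))) (*ˢ-unfoldʳ (f ∘ suc) g k))
          (sym (ℤ.+-assoc (f 0 * g (suc (suc k))) ((f ∘ suc *ˢ g ∘ suc) k) _))

  *ˢ-comm : ∀ f g → f *ˢ g ≗ g *ˢ f
  *ˢ-comm f g zero    = ℤ.*-comm (f 0) (g 0)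
  *ˢ-comm f g (suc k) =
    trans (cong₂ _+_ (ℤ.*-comm (f 0) (g (suc k))) (*ˢ-comm (f ∘ suc) g k))
          (trans (ℤ.+-comm (g (suc k) * f 0) ((g *ˢ f ∘ suc) k)) (sym (*ˢ-unfoldʳ g f k)))

  *ˢ-assoc : ∀ f g h → (f *ˢ g) *ˢ h ≗ f *ˢ (g *ˢ h)
  *ˢ-assoc f g h zero    = ℤ.*-assoc (f 0) (g 0) (h 0)
  *ˢ-assoc f g h (suc k) = begin
    (f *ˢ g) 0 * h (suc k) + (((λ j → f 0 * g (suc j)) +ˢ (f ∘ suc *ˢ g)) *ˢ h) k
      ≡⟨ cong (_+_ ((f *ˢ g) 0 * h (suc k))) (*ˢ-distribʳ _ _ h k) ⟩
    (f *ˢ g) 0 * h (suc k) + (((λ j → f 0 * g (suc j)) *ˢ h) k + ((f ∘ suc *ˢ g) *ˢ h) k)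
      ≡⟨ cong₂ (λ a b → (f *ˢ g) 0 * h (suc k) + (a + b))
               (*ˢ-scaleˡ (f 0) (g ∘ suc) h k) (*ˢ-assoc (f ∘ suc) g h k) ⟩
    f 0 * g 0 * h (suc k) + (f 0 * (g ∘ suc *ˢ h) k + (f ∘ suc *ˢ (g *ˢ h)) k)
      ≡⟨ regroup (f 0) (g 0) (h (suc k)) ((g ∘ suc *ˢ h) k) ((f ∘ suc *ˢ (g *ˢ h)) k) ⟩
    f 0 * (g 0 * h (suc k) + (g ∘ suc *ˢ h) k) + (f ∘ suc *ˢ (g *ˢ h)) k ∎
    where
    open ≡-Reasoning
    regroup : ∀ a b c d e → a * b * c + (a * d + e) ≡ a * (b * c + d) + e
    regroup = solve-∀

  *ˢ-congʳ : ∀ f {g g′} → g ≗ g′ → f *ˢ g ≗ f *ˢ g′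
  *ˢ-congʳ f {g} {g′} g≗g′ k = trans (*ˢ-comm f g k) (trans (*ˢ-congˡ f g≗g′ k) (*ˢ-comm g′ f k))

  *ˢ-identityʳ : ∀ f → f *ˢ 1ˢ ≗ f
  *ˢ-identityʳ f k = trans (*ˢ-comm f 1ˢ k) (*ˢ-identityˡ f k)

  *ˢ-distribˡ : ∀ f g g′ → f *ˢ (g +ˢ g′) ≗ f *ˢ g +ˢ f *ˢ g′
  *ˢ-distribˡ f g g′ k =
    trans (*ˢ-comm f (g +ˢ g′) k)
          (trans (*ˢ-distribʳ g g′ f k) (cong₂ _+_ (*ˢ-comm g f k) (*ˢ-comm g′ f k)))

  *ˢ-negʳ : ∀ f g → f *ˢ (-ˢ g) ≗ -ˢ (f *ˢ g)
  *ˢ-negʳ f g k = trans (*ˢ-comm f (-ˢ g) k) (trans (*ˢ-negˡ g f k) (cong -_ (*ˢ-comm g f k)))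

  *ˢ-difference : ∀ f g h → f *ˢ (g +ˢ -ˢ h) ≗ f *ˢ g +ˢ -ˢ (f *ˢ h)
  *ˢ-difference f g h k = trans (*ˢ-distribˡ f g (-ˢ h) k) (cong (_+_ ((f *ˢ g) k)) (*ˢ-negʳ f h k))

  shift-cong : ∀ a {f g} → f ≗ g → shift a f ≗ shift a g
  shift-cong zero    f≗g k       = f≗g k
  shift-cong (suc a) f≗g zero    = refl
  shift-cong (suc a) f≗g (suc k) = shift-cong a f≗g k

  shift-≥ : ∀ a f j → shift a f (a ℕ.+ j) ≡ f j
  shift-≥ zero    f j = refl
  shift-≥ (suc a) f j = shift-≥ a f j

  shift-< : ∀ a f k → k < a → shift a f k ≡ + 0
  shift-< (suc a) f zero    _         = refl
  shift-< (suc a) f (suc k) (s≤s k<a) = shift-< a f k k<a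

  shift-+ : ∀ a b f → shift a (shift b f) ≗ shift (a ℕ.+ b) f
  shift-+ zero    b f k       = refl
  shift-+ (suc a) b f zero    = refl
  shift-+ (suc a) b f (suc k) = shift-+ a b f k

  shift-+ˢ : ∀ a f g → shift a (f +ˢ g) ≗ shift a f +ˢ shift a g
  shift-+ˢ zero    f g k       = refl
  shift-+ˢ (suc a) f g zero    = refl
  shift-+ˢ (suc a) f g (suc k) = shift-+ˢ a f g k

  shift-*ˢ : ∀ a f g → shift a f *ˢ g ≗ shift a (f *ˢ g)
  shift-*ˢ zero    f g k       = *ˢ-congˡ g (λ _ → refl) k
  shift-*ˢ (suc a) f g zero    = refl
  shift-*ˢ (suc a) f g (suc k) =
    trans (cong (_+ (shift a f *ˢ g) k) (ℤ.*-zeroˡ (g (suc k))))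
          (trans (ℤ.+-identityˡ _) (shift-*ˢ a f g k))

  *ˢ-shift : ∀ e f g → f *ˢ shift e g ≗ shift e (f *ˢ g)
  *ˢ-shift e f g k =
    trans (*ˢ-comm f (shift e g) k) (trans (shift-*ˢ e g f k) (shift-cong e (*ˢ-comm g f) k))

  x^-*ˢ : ∀ a f → x^ a *ˢ f ≗ shift a f
  x^-*ˢ zero    f k       = *ˢ-identityˡ f k
  x^-*ˢ (suc a) f zero    = refl
  x^-*ˢ (suc a) f (suc k) =
    trans (cong (_+ (x^ a *ˢ f) k) (ℤ.*-zeroˡ (f (suc k)))) (trans (ℤ.+-identityˡ _) (x^-*ˢ a f k))

  1-x^-*ˢ : ∀ a f → (1-x^ a) *ˢ f ≗ f +ˢ -ˢ shift a f
  1-x^-*ˢ a f k =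
    trans (*ˢ-distribʳ 1ˢ (-ˢ x^ a) f k)
          (cong₂ _+_ (*ˢ-identityˡ f k) (trans (*ˢ-negˡ (x^ a) f k) (cong -_ (x^-*ˢ a f k))))

  1-x^-< : ∀ n k → k < n → (1-x^ n) k ≡ 1ˢ k
  1-x^-< n k k<n = trans (cong (λ z → 1ˢ k + - z) (shift-< n 1ˢ k k<n)) (ℤ.+-identityʳ (1ˢ k))

  ≗⇒≈ : ∀ {L f g} → f ≗ g → f ≈[ L ] g
  ≗⇒≈ f≗g k _ = f≗g k

  ≈⇒≗ : ∀ {f g} → (∀ L → f ≈[ L ] g) → f ≗ g
  ≈⇒≗ f≈g k = f≈g (suc k) k (ℕ.n<1+n k)

  ≈-weaken : ∀ {L L′ f g} → L′ ≤ L → f ≈[ L ] g → f ≈[ L′ ] g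
  ≈-weaken L′≤L f≈g k k<L′ = f≈g k (ℕ.<-≤-trans k<L′ L′≤L)

  *ˢ-cong : ∀ {L f f′ g g′} → f ≈[ L ] f′ → g ≈[ L ] g′ → f *ˢ g ≈[ L ] f′ *ˢ g′
  *ˢ-cong {f′ = f′} {g} {g′} f≈f′ g≈g′ k k<L =
    trans (*ˢ-causalˡ g k (λ j j≤k → f≈f′ j (ℕ.≤-<-trans j≤k k<L)))
          (trans (*ˢ-comm f′ g k)
                 (trans (*ˢ-causalˡ f′ k (λ j j≤k → g≈g′ j (ℕ.≤-<-trans j≤k k<L))) (*ˢ-comm g′ f′ k)))

  *ˢ-commutativeMonoid : ℕ → CommutativeMonoid 0ℓ 0ℓ
  *ˢ-commutativeMonoid L = record
    { Carrier = Series
    ; _≈_ = _≈[ L ]_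
    ; _∙_ = _*ˢ_
    ; ε = 1ˢ
    ; isCommutativeMonoid = record
      { isMonoid = record
        { isSemigroup = record
          { isMagma = record
            { isEquivalence = record
              { refl = λ _ _ → refl
              ; sym = λ f≈g k k<L → sym (f≈g k k<L)
              ; trans = λ f≈g g≈h k k<L → trans (f≈g k k<L) (g≈h k k<L) }
            ; ∙-cong = *ˢ-cong }
          ; assoc = λ f g h → ≗⇒≈ (*ˢ-assoc f g h) }
        ; identity = (λ f → ≗⇒≈ (*ˢ-identityˡ f)) , (λ f → ≗⇒≈ (*ˢ-identityʳ f)) }
      ; comm = λ f g → ≗⇒≈ (*ˢ-comm f g) } }

  *ˢ-leading : ∀ f h k → (∀ j → j < k → h j ≡ + 0) → (f *ˢ h) k ≡ f 0 * h k
  *ˢ-leading f h zero    _     = refl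
  *ˢ-leading f h (suc k) h<k≡0 =
    trans (cong (_+_ (f 0 * h (suc k))) (*ˢ-vanishing (f ∘ suc) h k (λ j j≤k → h<k≡0 j (s≤s j≤k))))
          (ℤ.+-identityʳ _)
    where
    *ˢ-vanishing : ∀ f h k → (∀ j → j ≤ k → h j ≡ + 0) → (f *ˢ h) k ≡ + 0
    *ˢ-vanishing f h k h≤k≡0 =
      trans (*ˢ-comm f h k) (trans (*ˢ-causalˡ f k h≤k≡0) (*ˢ-zeroˡ f k))

  *ˢ-cancelˡ : ∀ {L f g h} → f 0 * f 0 ≡ + 1 → f *ˢ g ≈[ L ] f *ˢ h → g ≈[ L ] h
  *ˢ-cancelˡ {L} {f} {g} {h} f₀²≡1 fg≈fh k k<L =
    ℤ.i-j≡0⇒i≡j (g k) (h k) (vanishes (suc k) k<L k (ℕ.n<1+n k))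
    where
    d : Series
    d = g +ˢ -ˢ h
    fd≡0 : ∀ k → k < L → (f *ˢ d) k ≡ + 0
    fd≡0 k k<L = trans (*ˢ-difference f g h k) (ℤ.i≡j⇒i-j≡0 (fg≈fh k k<L))
    vanishes : ∀ n → n ≤ L → ∀ j → j < n → d j ≡ + 0
    vanishes (suc n) n<L j j<1+n with ℕ.m<1+n⇒m<n∨m≡n j<1+n
    ... | inj₁ j<n  = vanishes n (ℕ.<⇒≤ n<L) j j<n
    ... | inj₂ refl = begin
      d j                  ≡⟨ sym (ℤ.*-identityˡ (d j)) ⟩
      + 1 * d j            ≡⟨ cong (_* d j) (sym f₀²≡1) ⟩
      f 0 * f 0 * d j      ≡⟨ ℤ.*-assoc (f 0) (f 0) (d j) ⟩
      f 0 * (f 0 * d j)    ≡⟨ cong (f 0 *_) (sym (*ˢ-leading f d j (vanishes n (ℕ.<⇒≤ n<L)))) ⟩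
      f 0 * (f *ˢ d) j     ≡⟨ cong (f 0 *_) (fd≡0 j n<L) ⟩
      f 0 * + 0            ≡⟨ ℤ.*-zeroʳ (f 0) ⟩
      + 0                  ∎
      where open ≡-Reasoning

module PolynomialSeries where

  open import Data.Nat using (zero; suc; _≤_; s≤s)
  open import Data.Integer using (+_; -_; -[1+_]; _+_; _*_)
  import Data.Integer.Properties as ℤ
  open import Data.Integer.Tactic.RingSolver using (solve-∀)
  open import Data.List using ([]; _∷_; _++_; length; replicate)
  open import Relation.Binary.PropositionalEquality
  open import Defs
  open PowerSeries

  coeff-+ₚ : ∀ p q → coeff (p +ₚ q) ≗ coeff p +ˢ coeff q
  coeff-+ₚ []      q       k       = sym (ℤ.+-identityˡ (coeff q k))
  coeff-+ₚ (a ∷ p) []      k       = sym (ℤ.+-identityʳ (coeff (a ∷ p) k))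
  coeff-+ₚ (a ∷ p) (b ∷ q) zero    = refl
  coeff-+ₚ (a ∷ p) (b ∷ q) (suc k) = coeff-+ₚ p q k

  coeff-·ₚ : ∀ c p k → coeff (c ·ₚ p) k ≡ c * coeff p k
  coeff-·ₚ c []      k       = sym (ℤ.*-zeroʳ c)
  coeff-·ₚ c (a ∷ p) zero    = refl
  coeff-·ₚ c (a ∷ p) (suc k) = coeff-·ₚ c p k

  coeff-*ₚ : ∀ p q → coeff (p *ₚ q) ≗ coeff p *ˢ coeff q
  coeff-*ₚ []      q k       = sym (*ˢ-zeroˡ (coeff q) k)
  coeff-*ₚ (a ∷ p) q zero    =
    trans (coeff-+ₚ (a ·ₚ q) (+ 0 ∷ p *ₚ q) 0) (trans (ℤ.+-identityʳ _) (coeff-·ₚ a q 0))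
  coeff-*ₚ (a ∷ p) q (suc k) =
    trans (coeff-+ₚ (a ·ₚ q) (+ 0 ∷ p *ₚ q) (suc k)) (cong₂ _+_ (coeff-·ₚ a q (suc k)) (coeff-*ₚ p q k))

  coeff-oneₚ : coeff oneₚ ≗ 1ˢ
  coeff-oneₚ zero    = refl
  coeff-oneₚ (suc k) = refl

  coeff-xⁿ-1 : ∀ n → coeff (xⁿ-1 (suc n)) ≗ -ˢ (1-x^ suc n)
  coeff-xⁿ-1 n zero    = refl
  coeff-xⁿ-1 n (suc k) =
    trans (coeff-xⁿ n k) (sym (trans (cong -_ (ℤ.+-identityˡ _)) (ℤ.neg-involutive ((x^ n) k))))
    where
    coeff-xⁿ : ∀ n k → coeff (replicate n (+ 0) ++ + 1 ∷ []) k ≡ (x^ n) k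
    coeff-xⁿ zero    zero    = refl
    coeff-xⁿ zero    (suc k) = refl
    coeff-xⁿ (suc n) zero    = refl
    coeff-xⁿ (suc n) (suc k) = coeff-xⁿ n k

  coeff-beyond-length : ∀ p k → length p ≤ k → coeff p k ≡ + 0
  coeff-beyond-length []      k       _         = refl
  coeff-beyond-length (a ∷ p) (suc k) (s≤s ℓ≤k) = coeff-beyond-length p k ℓ≤k

  length-serDiv : ∀ N a b → length (serDiv N a b) ≡ N
  length-serDiv zero    a b = refl
  length-serDiv (suc N) a b = cong suc (length-serDiv N _ b)

  coeff-tailₚ : ∀ p k → coeff (tailₚ p) k ≡ coeff p (suc k)
  coeff-tailₚ []      k = refl
  coeff-tailₚ (a ∷ p) k = refl

  headℤ≡coeff₀ : ∀ p → headℤ p ≡ coeff p 0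
  headℤ≡coeff₀ []      = refl
  headℤ≡coeff₀ (a ∷ p) = refl

  serDiv-correct : ∀ N a b → headℤ b * headℤ b ≡ + 1 → coeff b *ˢ coeff (serDiv N a b) ≈[ N ] coeff a
  serDiv-correct (suc N) a b b₀²≡1 zero _ = begin
    coeff b 0 * (headℤ a * headℤ b)   ≡⟨ cong (_* (headℤ a * headℤ b)) (sym (headℤ≡coeff₀ b)) ⟩
    headℤ b * (headℤ a * headℤ b)     ≡⟨ swap (headℤ b) (headℤ a) ⟩
    headℤ a * (headℤ b * headℤ b)     ≡⟨ cong (headℤ a *_) b₀²≡1 ⟩
    headℤ a * + 1                     ≡⟨ ℤ.*-identityʳ _ ⟩
    headℤ a                           ≡⟨ headℤ≡coeff₀ a ⟩
    coeff a 0                         ∎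
    where
    open ≡-Reasoning
    swap : ∀ x y → x * (y * x) ≡ y * (x * x)
    swap = solve-∀
  serDiv-correct (suc N) a b b₀²≡1 (suc k) (s≤s k<N) = begin
    (coeff b *ˢ coeff (c ∷ q)) (suc k)
      ≡⟨ *ˢ-unfoldʳ (coeff b) (coeff (c ∷ q)) k ⟩
    (coeff b *ˢ coeff q) k + coeff b (suc k) * c
      ≡⟨ cong (_+ coeff b (suc k) * c) (serDiv-correct N r b b₀²≡1 k k<N) ⟩
    coeff r k + coeff b (suc k) * c
      ≡⟨ cong (_+ coeff b (suc k) * c) remainder ⟩
    coeff a (suc k) + -[1+ 0 ] * (c * coeff b (suc k)) + coeff b (suc k) * c
      ≡⟨ cancel (coeff a (suc k)) c (coeff b (suc k)) ⟩
    coeff a (suc k) ∎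
    where
    open ≡-Reasoning
    c = headℤ a * headℤ b
    r = tailₚ (a -ₚ c ·ₚ b)
    q = serDiv N r b
    remainder : coeff r k ≡ coeff a (suc k) + -[1+ 0 ] * (c * coeff b (suc k))
    remainder = begin
      coeff r k                                            ≡⟨ coeff-tailₚ (a -ₚ c ·ₚ b) k ⟩
      coeff (a -ₚ c ·ₚ b) (suc k)                          ≡⟨ coeff-+ₚ a _ (suc k) ⟩
      coeff a (suc k) + coeff (-[1+ 0 ] ·ₚ (c ·ₚ b)) (suc k)
        ≡⟨ cong (_+_ (coeff a (suc k))) (coeff-·ₚ -[1+ 0 ] (c ·ₚ b) (suc k)) ⟩
      coeff a (suc k) + -[1+ 0 ] * coeff (c ·ₚ b) (suc k)
        ≡⟨ cong (λ z → coeff a (suc k) + -[1+ 0 ] * z) (coeff-·ₚ c b (suc k)) ⟩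
      coeff a (suc k) + -[1+ 0 ] * (c * coeff b (suc k))   ∎
    cancel : ∀ x y z → x + -[1+ 0 ] * (y * z) + z * y ≡ x
    cancel = solve-∀

module CyclotomicIdentity where

  open import Data.Nat using (zero; suc; _≤_; _<_; _≤?_; z≤n; s≤s; NonZero; ≢-nonZero⁻¹)
  import Data.Nat.Properties as ℕ
  open import Data.Nat.Divisibility using (_∣_; _∣?_; 0∣⇒≡0)
  open import Data.Integer using (+_; -_; _*_)
  import Data.Integer.Properties as ℤ
  open import Data.List using (List; []; _∷_; _∷ʳ_; foldr; filter; upTo)
  open import Data.List.Membership.Propositional using (_∈_)
  open import Data.List.Membership.Propositional.Properties using (∈-filter⁺; ∈-filter⁻; ∈-upTo⁺; ∈-upTo⁻)
  open import Data.List.Relation.Unary.All as All using (All; []; _∷_)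
  import Data.List.Relation.Unary.All.Properties as All
  open import Data.List.Relation.Unary.Linked using (Linked)
  open import Data.List.Relation.Unary.Linked.Properties using (Linked⇒AllPairs)
  open import Data.List.Relation.Unary.Any using (here; there)
  open import Data.List.Relation.Unary.AllPairs using (AllPairs; []; _∷_)
  import Data.List.Relation.Unary.AllPairs.Properties as AllPairs
  open import Data.Product using (_×_; _,_; proj₁; proj₂)
  open import Data.Empty using (⊥-elim)
  open import Data.Sum using (inj₁; inj₂)
  open import Function using (id)
  open import Relation.Nullary using (yes; no)
  open import Relation.Nullary.Decidable using (_×-dec_)
  open import Relation.Binary.PropositionalEquality
  open import Defs
  open PowerSeries
  open PolynomialSeries

  strictly-sorted-unique : ∀ {xs ys : List ℕ} → AllPairs _<_ xs → AllPairs _<_ ys →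
    (∀ {z} → z ∈ xs → z ∈ ys) → (∀ {z} → z ∈ ys → z ∈ xs) → xs ≡ ys
  strictly-sorted-unique []         []       _   _   = refl
  strictly-sorted-unique []         (_ ∷ _)  _   ys⊆ with () ← ys⊆ (here refl)
  strictly-sorted-unique (_ ∷ _)    []       xs⊆ _   with () ← xs⊆ (here refl)
  strictly-sorted-unique {x ∷ xs} {y ∷ ys} (x<xs ∷ xs<) (y<ys ∷ ys<) xs⊆ ys⊆ =
    cong₂ _∷_ x≡y (strictly-sorted-unique xs< ys<
      (λ z∈xs → drop-head x<xs z∈xs (subst (λ a → _ ∈ a ∷ ys) (sym x≡y) (xs⊆ (there z∈xs))))
      (λ z∈ys → drop-head y<ys z∈ys (subst (λ a → _ ∈ a ∷ xs) x≡y (ys⊆ (there z∈ys)))))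
    where
    x≡y : x ≡ y
    x≡y with xs⊆ (here refl) | ys⊆ (here refl)
    ... | here x≡y   | _          = x≡y
    ... | there _    | here y≡x   = sym y≡x
    ... | there x∈ys | there y∈xs = ⊥-elim (ℕ.<-asym (All.lookup y<ys x∈ys) (All.lookup x<xs y∈xs))
    drop-head : ∀ {a z as bs} → All (a <_) as → z ∈ as → z ∈ a ∷ bs → z ∈ bs
    drop-head a<as z∈as (here refl) = ⊥-elim (ℕ.<-irrefl refl (All.lookup a<as z∈as))
    drop-head a<as z∈as (there z∈bs) = z∈bs

  -- The list multiplied out in Defs.prodProperDivs, so that Φ-suc holds by unfolding.
  properDivisors : ℕ → List ℕ
  properDivisors n = filter (λ d → (1 ≤? d) ×-dec (d ∣? n)) (upTo n)

  ProperDivisor : ℕ → ℕ → Set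
  ProperDivisor n d = (1 ≤ d × d ∣ n) × d < n

  divisor-positive : ∀ {n d} .{{_ : NonZero n}} → d ∣ n → 1 ≤ d
  divisor-positive {n} {zero}  0∣n = ⊥-elim (≢-nonZero⁻¹ n (0∣⇒≡0 0∣n))
  divisor-positive {d = suc d} _   = s≤s z≤n

  properDivisors-≡ : ∀ n .{{_ : NonZero n}} xs → Linked _<_ (xs ∷ʳ n) → All (_∣ n) xs →
    (∀ {d} → ProperDivisor n d → d ∈ xs) → properDivisors n ≡ xs
  properDivisors-≡ n xs xs<n divide complete =
    strictly-sorted-unique (AllPairs.filter⁺ _ (AllPairs.applyUpTo⁺₁ id n (λ i<j _ → i<j))) xs<
      (λ d∈ → let d∈upTo , d∣n = ∈-filter⁻ _ d∈ in complete (d∣n , ∈-upTo⁻ d∈upTo))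
      (λ d∈xs → let d∣n = All.lookup divide d∈xs in
        ∈-filter⁺ _ (∈-upTo⁺ (All.lookup below-n d∈xs)) (divisor-positive d∣n , d∣n))
    where
    split : ∀ ys → AllPairs _<_ (ys ∷ʳ n) → AllPairs _<_ ys × All (_< n) ys
    split []       _                = [] , []
    split (y ∷ ys) (y<ys++n ∷ ys++n<) =
      let ys< , ys<n = split ys ys++n< in
      (All.++⁻ˡ ys y<ys++n ∷ ys<) , (All.head (All.++⁻ʳ ys y<ys++n) ∷ ys<n)
    xs< = proj₁ (split xs (Linked⇒AllPairs ℕ.<-trans xs<n))
    below-n = proj₂ (split xs (Linked⇒AllPairs ℕ.<-trans xs<n))

  properDivisor-< : ∀ {n d} → d ∈ properDivisors n → d < n
  properDivisor-< d∈ = ∈-upTo⁻ (proj₁ (∈-filter⁻ _ d∈))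

  ∏ₚ : List ℕ → Poly
  ∏ₚ = foldr (λ d acc → Φ d *ₚ acc) oneₚ

  ∏ˢ : List ℕ → Series
  ∏ˢ = foldr (λ d s → coeff (Φ d) *ˢ s) 1ˢ

  ∏ˢ-constant : ∀ ds → All (λ d → coeff (Φ d) 0 ≡ + 1) ds → ∏ˢ ds 0 ≡ + 1
  ∏ˢ-constant []       []               = refl
  ∏ˢ-constant (d ∷ ds) (Φ₀≡1 ∷ Φ₀s≡1) = cong₂ _*_ Φ₀≡1 (∏ˢ-constant ds Φ₀s≡1)

  coeff-∏ₚ : ∀ xs → coeff (∏ₚ xs) ≗ ∏ˢ xs
  coeff-∏ₚ []       = coeff-oneₚ
  coeff-∏ₚ (d ∷ xs) k = trans (coeff-*ₚ (Φ d) (∏ₚ xs) k) (*ˢ-congʳ (coeff (Φ d)) (coeff-∏ₚ xs) k)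

  cycTable-stable : ∀ n k → k ≤ n → cycTable n k ≡ Φ k
  cycTable-stable zero    zero z≤n   = refl
  cycTable-stable (suc n) k    k≤1+n with ℕ.m≤n⇒m<n∨m≡n k≤1+n
  ... | inj₂ refl    = refl
  ... | inj₁ (s≤s k≤n) = trans (unchanged k≤n) (cycTable-stable n k k≤n)
    where
    unchanged : k ≤ n → cycTable (suc n) k ≡ cycTable n k
    unchanged k≤n with k ≤? n
    ... | yes _   = refl
    ... | no  k≰n = ⊥-elim (k≰n k≤n)

  Φ-suc : ∀ n → Φ (suc n) ≡ serDiv (suc (suc n)) (xⁿ-1 (suc n)) (∏ₚ (properDivisors (suc n)))
  Φ-suc n with suc n ≤? n
  ... | yes 1+n≤n = ⊥-elim (ℕ.<-irrefl refl 1+n≤n)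
  ... | no  _     = cong (serDiv (suc (suc n)) (xⁿ-1 (suc n))) (∏-cong (properDivisors (suc n)) λ {d} d∈ →
                      cycTable-stable n d (ℕ.≤-pred (properDivisor-< {suc n} d∈)))
    where
    ∏-cong : ∀ xs → (∀ {d} → d ∈ xs → cycTable n d ≡ Φ d) →
      foldr (λ d acc → cycTable n d *ₚ acc) oneₚ xs ≡ ∏ₚ xs
    ∏-cong []       _     = refl
    ∏-cong (d ∷ xs) table = cong₂ _*ₚ_ (table (here refl)) (∏-cong xs (λ d∈ → table (there d∈)))

  coeff-Φ₁ : coeff (Φ 1) ≗ -ˢ (1-x^ 1)
  coeff-Φ₁ 0             = refl
  coeff-Φ₁ 1             = refl
  coeff-Φ₁ (suc (suc k)) = refl

  Φ-degree : ∀ n k → suc n < k → coeff (Φ (suc n)) k ≡ + 0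
  Φ-degree n k n<k rewrite Φ-suc n =
    coeff-beyond-length q k (subst (_≤ k) (sym (length-serDiv (suc (suc n)) (xⁿ-1 (suc n)) b)) n<k)
    where
    b = ∏ₚ (properDivisors (suc n))
    q = serDiv (suc (suc n)) (xⁿ-1 (suc n)) b

  module _ (n : ℕ) {ds : List ℕ} (divisors : properDivisors (suc n) ≡ 1 ∷ ds) (∏₀≡1 : ∏ˢ ds 0 ≡ + 1) where

    Φ-identity : (1-x^ 1) *ˢ ∏ˢ ds *ˢ coeff (Φ (suc n)) ≈[ suc (suc n) ] 1-x^ suc n
    Φ-identity k k<N = ℤ.neg-injective (begin
      - ((1-x^ 1) *ˢ ∏ˢ ds *ˢ coeff (Φ (suc n))) k  ≡⟨ sym (*ˢ-negˡ _ _ k) ⟩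
      (-ˢ ((1-x^ 1) *ˢ ∏ˢ ds) *ˢ coeff (Φ (suc n))) k
        ≡⟨ *ˢ-congˡ _ (λ j → trans (sym (*ˢ-negˡ _ _ j)) (*ˢ-congˡ _ (λ i → sym (coeff-Φ₁ i)) j)) k ⟩
      (∏ˢ (1 ∷ ds) *ˢ coeff (Φ (suc n))) k          ≡⟨ *ˢ-congˡ _ (λ j → sym (coeff-∏ₚ (1 ∷ ds) j)) k ⟩
      (coeff b *ˢ coeff (Φ (suc n))) k
        ≡⟨ cong (λ p → (coeff b *ˢ coeff p) k) Φ-quotient ⟩
      (coeff b *ˢ coeff (serDiv (suc (suc n)) (xⁿ-1 (suc n)) b)) k
        ≡⟨ serDiv-correct (suc (suc n)) (xⁿ-1 (suc n)) b b₀²≡1 k k<N ⟩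
      coeff (xⁿ-1 (suc n)) k                        ≡⟨ coeff-xⁿ-1 n k ⟩
      - (1-x^ suc n) k                              ∎)
      where
      open ≡-Reasoning
      b = ∏ₚ (1 ∷ ds)
      Φ-quotient : Φ (suc n) ≡ serDiv (suc (suc n)) (xⁿ-1 (suc n)) b
      Φ-quotient = trans (Φ-suc n) (cong (λ xs → serDiv (suc (suc n)) (xⁿ-1 (suc n)) (∏ₚ xs)) divisors)
      b₀²≡1 : headℤ b * headℤ b ≡ + 1
      b₀²≡1 rewrite headℤ≡coeff₀ b | coeff-∏ₚ (1 ∷ ds) 0 | ∏₀≡1 = refl

    Φ-unique : ∀ t → (1-x^ 1) *ˢ ∏ˢ ds *ˢ t ≈[ suc (suc n) ] 1-x^ suc n →
      (∀ k → suc n < k → t k ≡ + 0) → coeff (Φ (suc n)) ≗ t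
    Φ-unique t identity t-degree k with k ℕ.<? suc (suc n)
    ... | yes k<N = *ˢ-cancelˡ unit (λ j j<N → trans (Φ-identity j j<N) (sym (identity j j<N))) k k<N
      where
      unit : ((1-x^ 1) *ˢ ∏ˢ ds) 0 * ((1-x^ 1) *ˢ ∏ˢ ds) 0 ≡ + 1
      unit rewrite ∏₀≡1 = refl
    ... | no  k≮N = trans (Φ-degree n k n<k) (sym (t-degree k n<k))
      where n<k = ℕ.≤-pred (ℕ.≰⇒> k≮N)

module PrimeDivisors where

  open import Data.Nat as ℕ using (_+_; _*_; _<_; z≤n; s≤s)
  import Data.Nat.Properties as ℕ
  open import Data.Nat.Divisibility using (_∣_; _∣?_; divides; 1∣_; m∣m*n; n∣m*n; ∣m⇒∣m*n; *-cancelʳ-∣)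
  open import Data.Nat.Coprimality using (Coprime; coprime-divisor)
  import Data.Nat.Tactic.RingSolver as ℕ-Solver
  open import Data.Nat.Primality using (Prime; prime⇒irreducible; prime⇒nonZero; prime⇒nonTrivial; prime?)
  open import Data.List using ([]; _∷_)
  open import Data.List.Membership.Propositional using (_∈_)
  open import Data.List.Relation.Unary.All using ([]; _∷_)
  open import Data.List.Relation.Unary.Any using (here; there)
  open import Data.List.Relation.Unary.Linked using ([]; [-]; _∷_)
  open import Data.Product using (∃-syntax; _×_; _,_)
  open import Data.Sum using (_⊎_; inj₁; inj₂)
  open import Data.Empty using (⊥-elim)
  open import Relation.Nullary using (yes; no)
  open import Relation.Nullary.Decidable using (from-yes)
  open import Relation.Binary.PropositionalEquality
  open CyclotomicIdentity

  prime-3 : Prime 3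
  prime-3 = from-yes (prime? 3)

  prime>1 : ∀ {p} → Prime p → 1 < p
  prime>1 {p} p-prime = ℕ.nonTrivial⇒n>1 p ⦃ prime⇒nonTrivial p-prime ⦄

  prime-multiple-divisor : ∀ {p d} k → Prime p → d ∣ k * p → d ∣ k ⊎ ∃[ e ] e ∣ k × d ≡ e * p
  prime-multiple-divisor {p} {d} k p-prime d∣kp with p ∣? d
  ... | yes (divides e refl) = inj₂ (e , *-cancelʳ-∣ p ⦃ prime⇒nonZero p-prime ⦄ d∣kp , refl)
  ... | no  p∤d              = inj₁ (coprime-divisor d⊥p (subst (d ∣_) (ℕ.*-comm k p) d∣kp))
    where
    d⊥p : Coprime d p
    d⊥p (i∣d , i∣p) with prime⇒irreducible p-prime i∣p
    ... | inj₁ i≡1  = i≡1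
    ... | inj₂ refl = ⊥-elim (p∤d i∣d)

  pq-divisor : ∀ {p q d} → Prime p → Prime q → d ∣ p * q → d ∈ 1 ∷ p ∷ q ∷ p * q ∷ []
  pq-divisor p-prime q-prime d∣pq with prime-multiple-divisor _ q-prime d∣pq
  ... | inj₁ d∣p with prime⇒irreducible p-prime d∣p
  ...   | inj₁ refl = here refl
  ...   | inj₂ refl = there (here refl)
  pq-divisor {q = q} p-prime q-prime d∣pq | inj₂ (e , e∣p , refl) with prime⇒irreducible p-prime e∣p
  ...   | inj₁ refl = there (there (here (ℕ.*-identityˡ q)))
  ...   | inj₂ refl = there (there (there (here refl)))

  properDivisors-prime : ∀ {p} → Prime p → properDivisors p ≡ 1 ∷ []
  properDivisors-prime {p} p-prime =
    properDivisors-≡ p ⦃ prime⇒nonZero p-prime ⦄ (1 ∷ []) (prime>1 p-prime ∷ [-]) (1∣ p ∷ []) complete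
    where
    complete : ∀ {d} → ProperDivisor p d → d ∈ 1 ∷ []
    complete ((_ , d∣p) , d<p) with prime⇒irreducible p-prime d∣p
    ... | inj₁ refl = here refl
    ... | inj₂ refl = ⊥-elim (ℕ.<-irrefl refl d<p)

  properDivisors-pq : ∀ {p q} → Prime p → Prime q → p < q → properDivisors (p * q) ≡ 1 ∷ p ∷ q ∷ []
  properDivisors-pq {p} {q} p-prime q-prime p<q =
    properDivisors-≡ (p * q) ⦃ ℕ.m*n≢0 p q ⦄ (1 ∷ p ∷ q ∷ []) (prime>1 p-prime ∷ p<q ∷ q<pq ∷ [-])
      (1∣ _ ∷ m∣m*n q ∷ n∣m*n p ∷ []) complete
    where
    instance
      _ = prime⇒nonZero p-prime
      _ = prime⇒nonZero q-prime
    q<pq : q < p * q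
    q<pq = subst (q <_) (ℕ.*-comm q p) (ℕ.m<m*n q p (prime>1 p-prime))
    complete : ∀ {d} → ProperDivisor (p * q) d → d ∈ 1 ∷ p ∷ q ∷ []
    complete ((_ , d∣pq) , d<pq) with pq-divisor p-prime q-prime d∣pq
    ... | here d≡1                 = here d≡1
    ... | there (here d≡p)         = there (here d≡p)
    ... | there (there (here d≡q)) = there (there (here d≡q))
    ... | there (there (there (here refl))) = ⊥-elim (ℕ.<-irrefl refl d<pq)

  properDivisors-3pq : ∀ {p q} → Prime p → Prime q → 3 < p → 3 * p < q →
    properDivisors (3 * p * q) ≡ 1 ∷ 3 ∷ p ∷ 3 * p ∷ q ∷ 3 * q ∷ p * q ∷ []
  properDivisors-3pq {p} {q} p-prime q-prime 3<p 3p<q =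
    properDivisors-≡ (3 * p * q) ⦃ ℕ.m*n≢0 (3 * p) q ⦃ ℕ.m*n≢0 3 p ⦄ ⦄ _
      (s≤s (s≤s z≤n) ∷ 3<p ∷ n<3n p ∷ 3p<q ∷ n<3n q ∷ ℕ.*-monoˡ-< q 3<p ∷ ℕ.*-monoˡ-< q (n<3n p)
        ∷ [-])
      (1∣ _ ∷ ∣m⇒∣m*n q (m∣m*n p) ∷ ∣m⇒∣m*n q (n∣m*n 3) ∷ m∣m*n q ∷ n∣m*n (3 * p)
        ∷ divides p (rearrange p q) ∷ divides 3 (ℕ.*-assoc 3 p q) ∷ [])
      complete
    where
    instance
      _ = prime⇒nonZero p-prime
      _ = prime⇒nonZero q-prime
    n<3n : ∀ n .{{_ : ℕ.NonZero n}} → n < 3 * n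
    n<3n n = ℕ.m<m+n n (ℕ.<-≤-trans (ℕ.>-nonZero⁻¹ n) (ℕ.m≤m+n n (n + 0)))
    rearrange : ∀ p q → 3 * p * q ≡ p * (3 * q)
    rearrange = ℕ-Solver.solve-∀
    complete : ∀ {d} → ProperDivisor (3 * p * q) d → d ∈ 1 ∷ 3 ∷ p ∷ 3 * p ∷ q ∷ 3 * q ∷ p * q ∷ []
    complete ((_ , d∣n) , d<n) with prime-multiple-divisor (3 * p) q-prime d∣n
    ... | inj₁ d∣3p with pq-divisor prime-3 p-prime d∣3p
    ...   | here refl                         = here refl
    ...   | there (here refl)                 = there (here refl)
    ...   | there (there (here refl))         = there (there (here refl))
    ...   | there (there (there (here refl))) = there (there (there (here refl)))
    complete ((_ , d∣n) , d<n) | inj₂ (e , e∣3p , refl) with pq-divisor prime-3 p-prime e∣3p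
    ...   | here refl                         = there (there (there (there (here (ℕ.*-identityˡ q)))))
    ...   | there (here refl)                 = there (there (there (there (there (here refl)))))
    ...   | there (there (here refl))         = there (there (there (there (there (there (here refl))))))
    ...   | there (there (there (here refl))) = ⊥-elim (ℕ.<-irrefl refl d<n)

module CommutativeMonoidSolver {c ℓ} (M : CommutativeMonoid c ℓ) where

  open import Algebra.Solver.CommutativeMonoid M using (_⊕_; Expr)
  open import Algebra.Solver.CommutativeMonoid M public using (solve; _⊜_; id)

  -- _⊕_ is right-associative; _⊙_ matches the left-nested products used below.
  infixl 7 _⊙_
  _⊙_ : ∀ {n} → Expr n → Expr n → Expr n
  _⊙_ = _⊕_

module Elimination {c ℓ} (M : CommutativeMonoid c ℓ) where

  open CommutativeMonoid M
  open import Relation.Binary.Reasoning.Setoid setoid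
  open CommutativeMonoidSolver M

  infixl 7 _·_
  _·_ = _∙_

  -- Read u_d = 1 - x^d, oₚ = Φ_p, tₚ = Φ_{3p}, w = Φ_{pq}, s = Φ_{3pq}: the hypotheses are the
  -- identities ∏_{d ∣ n} Φ_d = xⁿ - 1 modulo x^(pq), together with (1 - x^(3p)) h = Φ_3 (1 - x^p).
  eliminate : ∀ {u₁ o₃ oₚ o_q tₚ t_q w s uₚ u_q u₃ₚ u₃_q h} →
    u₁ · oₚ ≈ uₚ → u₁ · o_q ≈ u_q → u₁ · o₃ · oₚ · tₚ ≈ u₃ₚ → u₁ · o₃ · o_q · t_q ≈ u₃_q →
    u₁ · oₚ · o_q · w ≈ ε → u₃ₚ · h ≈ o₃ · uₚ → u₁ · o₃ · oₚ · tₚ · o_q · t_q · w · s ≈ ε →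
    u₁ · o₃ · oₚ · (u₃_q · s) ≈ u₁ · o₃ · oₚ · (u_q · h)
  eliminate {u₁} {o₃} {oₚ} {o_q} {tₚ} {t_q} {w} {s} {uₚ} {u_q} {u₃ₚ} {u₃_q} {h}
            uₚ≈ u_q≈ u₃ₚ≈ u₃_q≈ w≈ h≈ s≈ = sym (begin
    u₁ · o₃ · oₚ · (u_q · h)                  ≈⟨ ∙-congˡ (∙-congʳ (sym u_q≈)) ⟩
    u₁ · o₃ · oₚ · (u₁ · o_q · h)             ≈⟨ sym (identityʳ _) ⟩
    u₁ · o₃ · oₚ · (u₁ · o_q · h) · ε         ≈⟨ ∙-congˡ (sym s≈) ⟩
    u₁ · o₃ · oₚ · (u₁ · o_q · h) · (u₁ · o₃ · oₚ · tₚ · o_q · t_q · w · s)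
      ≈⟨ solve 9 (λ u₁ o₃ oₚ o_q tₚ t_q w s h →
           u₁ ⊙ o₃ ⊙ oₚ ⊙ (u₁ ⊙ o_q ⊙ h) ⊙ (u₁ ⊙ o₃ ⊙ oₚ ⊙ tₚ ⊙ o_q ⊙ t_q ⊙ w ⊙ s)
           ⊜ (u₁ ⊙ o₃ ⊙ o_q ⊙ t_q) ⊙ (u₁ ⊙ oₚ ⊙ o_q ⊙ w) ⊙ (u₁ ⊙ o₃ ⊙ oₚ ⊙ tₚ) ⊙ h ⊙ s)
           refl u₁ o₃ oₚ o_q tₚ t_q w s h ⟩
    (u₁ · o₃ · o_q · t_q) · (u₁ · oₚ · o_q · w) · (u₁ · o₃ · oₚ · tₚ) · h · s
      ≈⟨ ∙-congʳ (∙-congʳ (∙-cong (∙-cong u₃_q≈ w≈) u₃ₚ≈)) ⟩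
    u₃_q · ε · u₃ₚ · h · s
      ≈⟨ solve 4 (λ u₃_q u₃ₚ h s → u₃_q ⊙ id ⊙ u₃ₚ ⊙ h ⊙ s ⊜ u₃_q ⊙ (u₃ₚ ⊙ h) ⊙ s) refl u₃_q u₃ₚ h s ⟩
    u₃_q · (u₃ₚ · h) · s
      ≈⟨ ∙-congʳ (∙-congˡ (trans h≈ (∙-congˡ (sym uₚ≈)))) ⟩
    u₃_q · (o₃ · (u₁ · oₚ)) · s
      ≈⟨ solve 5 (λ u₁ o₃ oₚ u₃_q s → u₃_q ⊙ (o₃ ⊙ (u₁ ⊙ oₚ)) ⊙ s ⊜ u₁ ⊙ o₃ ⊙ oₚ ⊙ (u₃_q ⊙ s))
           refl u₁ o₃ oₚ u₃_q s ⟩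
    u₁ · o₃ · oₚ · (u₃_q · s) ∎)

module ExplicitCyclotomic where

  open import Data.Nat using (zero; suc; _+_; _*_; _≤_; _<_; z≤n; s≤s)
  import Data.Nat.Properties as ℕ
  open import Data.Integer using (ℤ; +_; -_; -[1+_]) renaming (_+_ to _+ℤ_)
  import Data.Integer.Properties as ℤ
  open import Data.Integer.Tactic.RingSolver using (solve-∀)
  import Data.Nat.Tactic.RingSolver as ℕ-Solver
  open import Data.Nat.Primality using (Prime; ¬prime[0])
  open import Algebra.Bundles using (CommutativeMonoid)
  open import Data.Empty using (⊥-elim)
  open import Function using (_∘_)
  open import Data.List using ([]; _∷_)
  open import Data.List.Relation.Unary.All using ([]; _∷_)
  open import Relation.Binary.PropositionalEquality
  open import Defs
  open PowerSeries
  open PolynomialSeries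
  open CyclotomicIdentity
  open PrimeDivisors

  ones : ℕ → Series
  ones zero    k       = + 0
  ones (suc p) zero    = + 1
  ones (suc p) (suc k) = ones p k

  ones-beyond : ∀ p k → p ≤ k → ones p k ≡ + 0
  ones-beyond zero    k       _         = refl
  ones-beyond (suc p) (suc k) (s≤s p≤k) = ones-beyond p k p≤k

  ones-identity : ∀ p → (1-x^ 1) *ˢ ones p ≗ 1-x^ p
  ones-identity p k = trans (1-x^-*ˢ 1 (ones p) k) (telescope p k)
    where
    telescope : ∀ p → ones p +ˢ -ˢ shift 1 (ones p) ≗ 1-x^ p
    telescope zero    zero    = refl
    telescope zero    (suc k) = refl
    telescope (suc p) zero    = refl
    telescope (suc zero)    (suc zero)    = refl
    telescope (suc zero)    (suc (suc k)) = refl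
    telescope (suc (suc p)) (suc zero)    = refl
    telescope (suc (suc p)) (suc (suc k)) = telescope (suc p) (suc k)

  Φ-prime : ∀ {p} → Prime p → coeff (Φ p) ≗ ones p
  Φ-prime {zero}  p-prime = ⊥-elim (¬prime[0] p-prime)
  Φ-prime {suc p} p-prime = Φ-unique p (properDivisors-prime p-prime) refl (ones (suc p)) identity degree
    where
    identity : (1-x^ 1) *ˢ 1ˢ *ˢ ones (suc p) ≈[ suc (suc p) ] 1-x^ suc p
    identity = ≗⇒≈ λ k → trans (*ˢ-congˡ (ones (suc p)) (*ˢ-identityʳ (1-x^ 1)) k) (ones-identity (suc p) k)
    degree : ∀ k → suc p < k → ones (suc p) k ≡ + 0
    degree k p<k = ones-beyond (suc p) k (ℕ.<⇒≤ p<k)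

  module Truncated (L : ℕ) where
    open CommutativeMonoid (*ˢ-commutativeMonoid L) public
      using (∙-cong; ∙-congˡ; ∙-congʳ) renaming (setoid to ≈-setoid; refl to ≈-refl)
    open CommutativeMonoidSolver (*ˢ-commutativeMonoid L) public
    open import Relation.Binary.Reasoning.Setoid ≈-setoid public

  Φ-pq-identity : ∀ {p q} → Prime p → Prime q → p < q →
    (1-x^ 1) *ˢ ones p *ˢ ones q *ˢ coeff (Φ (p * q)) ≈[ p * q ] 1ˢ
  Φ-pq-identity {zero}  p-prime _ _ = ⊥-elim (¬prime[0] p-prime)
  Φ-pq-identity {suc _} {zero} _ q-prime _ = ⊥-elim (¬prime[0] q-prime)
  Φ-pq-identity {p@(suc _)} {q@(suc _)} p-prime q-prime p<q = begin
    (1-x^ 1) *ˢ ones p *ˢ ones q *ˢ coeff (Φ (p * q))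
      ≈⟨ solve 4 (λ u₁ oₚ o_q w → u₁ ⊙ oₚ ⊙ o_q ⊙ w ⊜ u₁ ⊙ (oₚ ⊙ (o_q ⊙ id)) ⊙ w) ≈-refl
           (1-x^ 1) (ones p) (ones q) (coeff (Φ (p * q))) ⟩
    (1-x^ 1) *ˢ (ones p *ˢ (ones q *ˢ 1ˢ)) *ˢ coeff (Φ (p * q))
      ≈⟨ ∙-congʳ (∙-congˡ (∙-cong (≗⇒≈ (sym ∘ Φ-prime p-prime))
                                 (∙-congʳ (≗⇒≈ (sym ∘ Φ-prime q-prime))))) ⟩
    (1-x^ 1) *ˢ ∏ˢ (p ∷ q ∷ []) *ˢ coeff (Φ (p * q))
      ≈⟨ ≈-weaken (ℕ.n≤1+n _) (Φ-identity _ (properDivisors-pq p-prime q-prime p<q) ∏₀≡1) ⟩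
    1-x^ (p * q)
      ≈⟨ (λ k k<pq → 1-x^-< (p * q) k k<pq) ⟩
    1ˢ ∎
    where
    open Truncated (p * q)
    ∏₀≡1 : ∏ˢ (p ∷ q ∷ []) 0 ≡ + 1
    ∏₀≡1 = ∏ˢ-constant (p ∷ q ∷ []) (Φ-prime p-prime 0 ∷ Φ-prime q-prime 0 ∷ [])

  period₃ : ℤ → ℤ → ℤ → Series
  period₃ a b c zero                = a
  period₃ a b c (suc zero)          = b
  period₃ a b c (suc (suc zero))    = c
  period₃ a b c (suc (suc (suc k))) = period₃ a b c k

  period₃-periodic : ∀ a b c t k → period₃ a b c (3 * t + k) ≡ period₃ a b c k
  period₃-periodic a b c zero    k = refl
  period₃-periodic a b c (suc t) k = trans (cong (period₃ a b c) (unfold t k)) (period₃-periodic a b c t k)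
    where
    unfold : ∀ t k → 3 * suc t + k ≡ 3 + (3 * t + k)
    unfold = ℕ-Solver.solve-∀

  shift-period₃ : ∀ {a b c} e d k {n} → e + (3 * d + k) ≡ n → shift e (period₃ a b c) n ≡ period₃ a b c k
  shift-period₃ {a} {b} {c} e d k refl = trans (shift-≥ e _ (3 * d + k)) (period₃-periodic a b c d k)

  period₃-minus-shift : ∀ {a b c B} e u v {y} → shift e B (3 * u + v) ≡ y →
    (period₃ a b c +ˢ -ˢ shift e B) (3 * u + v) ≡ period₃ a b c v +ℤ - y
  period₃-minus-shift e u v shifted = cong₂ (λ x y → x +ℤ - y) (period₃-periodic _ _ _ u v) shifted

  period₃-identity : ∀ a b c → (1-x^ 3) *ˢ period₃ a b c ≗ coeff (a ∷ b ∷ c ∷ [])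
  period₃-identity a b c k = trans (1-x^-*ˢ 3 (period₃ a b c) k) (difference k)
    where
    difference : period₃ a b c +ˢ -ˢ shift 3 (period₃ a b c) ≗ coeff (a ∷ b ∷ c ∷ [])
    difference zero                = ℤ.+-identityʳ a
    difference (suc zero)          = ℤ.+-identityʳ b
    difference (suc (suc zero))    = ℤ.+-identityʳ c
    difference (suc (suc (suc k))) = ℤ.+-inverseʳ (period₃ a b c k)

  [1-x]/[1-x³] [1-x²]/[1-x³] : Series
  [1-x]/[1-x³]  = period₃ (+ 1) -[1+ 0 ] (+ 0)
  [1-x²]/[1-x³] = period₃ (+ 1) (+ 0) -[1+ 0 ]

  [1-x]/[1-x³]-identity : (1-x^ 3) *ˢ [1-x]/[1-x³] ≗ 1-x^ 1
  [1-x]/[1-x³]-identity k = trans (period₃-identity _ _ _ k) (1-x k)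
    where
    1-x : coeff (+ 1 ∷ -[1+ 0 ] ∷ + 0 ∷ []) ≗ 1-x^ 1
    1-x zero                = refl
    1-x (suc zero)          = refl
    1-x (suc (suc zero))    = refl
    1-x (suc (suc (suc k))) = refl

  [1-x²]/[1-x³]-identity : (1-x^ 3) *ˢ [1-x²]/[1-x³] ≗ 1-x^ 2
  [1-x²]/[1-x³]-identity k = trans (period₃-identity _ _ _ k) (1-x² k)
    where
    1-x² : coeff (+ 1 ∷ + 0 ∷ -[1+ 0 ] ∷ []) ≗ 1-x^ 2
    1-x² zero                = refl
    1-x² (suc zero)          = refl
    1-x² (suc (suc zero))    = refl
    1-x² (suc (suc (suc k))) = refl

  [1-x]/[1-x³]-sum : ∀ j → [1-x]/[1-x³] j +ℤ [1-x]/[1-x³] (1 + j) +ℤ [1-x]/[1-x³] (2 + j) ≡ + 0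
  [1-x]/[1-x³]-sum zero                = refl
  [1-x]/[1-x³]-sum (suc zero)          = refl
  [1-x]/[1-x³]-sum (suc (suc zero))    = refl
  [1-x]/[1-x³]-sum (suc (suc (suc j))) = [1-x]/[1-x³]-sum j

  1-x^-geometric₃ : ∀ q → (1-x^ q) *ˢ (1ˢ +ˢ x^ q +ˢ x^ (q + q)) ≗ 1-x^ (3 * q)
  1-x^-geometric₃ q k = begin
    ((1-x^ q) *ˢ (1ˢ +ˢ x^ q +ˢ x^ (q + q))) k
      ≡⟨ 1-x^-*ˢ q _ k ⟩
    (1ˢ +ˢ x^ q +ˢ x^ (q + q)) k +ℤ - shift q (1ˢ +ˢ x^ q +ˢ x^ (q + q)) k
      ≡⟨ cong (λ z → (1ˢ +ˢ x^ q +ˢ x^ (q + q)) k +ℤ - z) shifted ⟩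
    1ˢ k +ℤ (x^ q) k +ℤ (x^ (q + q)) k +ℤ - ((x^ q) k +ℤ (x^ (q + q)) k +ℤ (x^ (3 * q)) k)
      ≡⟨ telescope (1ˢ k) ((x^ q) k) ((x^ (q + q)) k) ((x^ (3 * q)) k) ⟩
    (1-x^ (3 * q)) k ∎
    where
    open ≡-Reasoning
    telescope : ∀ a b c d → a +ℤ b +ℤ c +ℤ - (b +ℤ c +ℤ d) ≡ a +ℤ - d
    telescope = solve-∀
    q+[q+q]≡3q : q + (q + q) ≡ 3 * q
    q+[q+q]≡3q = cong (_+_ q) (cong (_+_ q) (sym (ℕ.+-identityʳ q)))
    shifted : shift q (1ˢ +ˢ x^ q +ˢ x^ (q + q)) k ≡ (x^ q) k +ℤ (x^ (q + q)) k +ℤ (x^ (3 * q)) k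
    shifted = begin
      shift q (1ˢ +ˢ x^ q +ˢ x^ (q + q)) k
        ≡⟨ shift-+ˢ q (1ˢ +ˢ x^ q) (x^ (q + q)) k ⟩
      shift q (1ˢ +ˢ x^ q) k +ℤ shift q (x^ (q + q)) k
        ≡⟨ cong₂ _+ℤ_ (trans (shift-+ˢ q 1ˢ (x^ q) k) (cong ((x^ q) k +ℤ_) (shift-+ q q 1ˢ k)))
                      (trans (shift-+ q (q + q) 1ˢ k) (cong (λ n → (x^ n) k) q+[q+q]≡3q)) ⟩
      (x^ q) k +ℤ (x^ (q + q)) k +ℤ (x^ (3 * q)) k ∎

  Φ3q-series : ℕ → Series
  Φ3q-series q = [1-x]/[1-x³] *ˢ (1ˢ +ˢ x^ q +ˢ x^ (q + q))

  Φ3q-series-identity : ∀ q → (1-x^ 1) *ˢ ones 3 *ˢ ones q *ˢ Φ3q-series q ≗ 1-x^ (3 * q)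
  Φ3q-series-identity q = ≈⇒≗ λ L → let open Truncated L in begin
    (1-x^ 1) *ˢ ones 3 *ˢ ones q *ˢ ([1-x]/[1-x³] *ˢ V)
      ≈⟨ solve 5 (λ u₁ o₃ o_q c v → u₁ ⊙ o₃ ⊙ o_q ⊙ (c ⊙ v) ⊜ u₁ ⊙ o₃ ⊙ c ⊙ o_q ⊙ v) ≈-refl
           (1-x^ 1) (ones 3) (ones q) [1-x]/[1-x³] V ⟩
    (1-x^ 1) *ˢ ones 3 *ˢ [1-x]/[1-x³] *ˢ ones q *ˢ V
      ≈⟨ ∙-congʳ (∙-congʳ (∙-congʳ (≗⇒≈ (ones-identity 3)))) ⟩
    (1-x^ 3) *ˢ [1-x]/[1-x³] *ˢ ones q *ˢ V
      ≈⟨ ∙-congʳ (∙-congʳ (≗⇒≈ [1-x]/[1-x³]-identity)) ⟩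
    (1-x^ 1) *ˢ ones q *ˢ V
      ≈⟨ ∙-congʳ (≗⇒≈ (ones-identity q)) ⟩
    (1-x^ q) *ˢ V
      ≈⟨ ≗⇒≈ (1-x^-geometric₃ q) ⟩
    1-x^ (3 * q) ∎
    where
    V = 1ˢ +ˢ x^ q +ˢ x^ (q + q)

  Φ3q-series-unfold : ∀ q → Φ3q-series q ≗ [1-x]/[1-x³] +ˢ shift q [1-x]/[1-x³] +ˢ shift (q + q) [1-x]/[1-x³]
  Φ3q-series-unfold q k = begin
    ([1-x]/[1-x³] *ˢ (1ˢ +ˢ x^ q +ˢ x^ (q + q))) k
      ≡⟨ *ˢ-distribˡ C (1ˢ +ˢ x^ q) (x^ (q + q)) k ⟩
    (C *ˢ (1ˢ +ˢ x^ q)) k +ℤ (C *ˢ x^ (q + q)) k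
      ≡⟨ cong₂ _+ℤ_ (trans (*ˢ-distribˡ C 1ˢ (x^ q) k) (cong₂ _+ℤ_ (*ˢ-identityʳ C k) (monomial q k)))
                    (monomial (q + q) k) ⟩
    C k +ℤ shift q C k +ℤ shift (q + q) C k ∎
    where
    open ≡-Reasoning
    C = [1-x]/[1-x³]
    monomial : ∀ a → C *ˢ x^ a ≗ shift a C
    monomial a k = trans (*ˢ-comm C (x^ a) k) (x^-*ˢ a C k)

  -- Past 2q the three shifted copies of the period-3 sequence 1, -1, 0 are out of phase (q ≡ 2 mod 3).
  Φ3q-series-degree : ∀ w k → let q = 2 + 3 * w in q + q ≤ k → Φ3q-series q k ≡ + 0
  Φ3q-series-degree w k 2q≤k = begin
    Φ3q-series q k
      ≡⟨ Φ3q-series-unfold q k ⟩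
    C k +ℤ shift q C k +ℤ shift (q + q) C k
      ≡⟨ cong (λ k → C k +ℤ shift q C k +ℤ shift (q + q) C k) (sym (ℕ.m+[n∸m]≡n 2q≤k)) ⟩
    C (q + q + j) +ℤ shift q C (q + q + j) +ℤ shift (q + q) C (q + q + j)
      ≡⟨ cong₂ _+ℤ_ (cong₂ _+ℤ_ first second) (shift-≥ (q + q) C j) ⟩
    C (1 + j) +ℤ C (2 + j) +ℤ C j
      ≡⟨ rotate (C j) (C (1 + j)) (C (2 + j)) ⟩
    C j +ℤ C (1 + j) +ℤ C (2 + j)
      ≡⟨ [1-x]/[1-x³]-sum j ⟩
    + 0 ∎
    where
    open ≡-Reasoning
    q = 2 + 3 * w
    C = [1-x]/[1-x³]
    j = k ℕ.∸ (q + q)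
    rotate : ∀ a b c → b +ℤ c +ℤ a ≡ a +ℤ b +ℤ c
    rotate = solve-∀
    first : C (q + q + j) ≡ C (1 + j)
    first = trans (cong C (index w j)) (period₃-periodic _ _ _ (1 + 2 * w) (1 + j))
      where
      index : ∀ w j → (2 + 3 * w) + (2 + 3 * w) + j ≡ 3 * (1 + 2 * w) + (1 + j)
      index = ℕ-Solver.solve-∀
    second : shift q C (q + q + j) ≡ C (2 + j)
    second = begin
      shift q C (q + q + j)     ≡⟨ cong (shift q C) (index w j) ⟩
      shift q C (q + (3 * w + (2 + j))) ≡⟨ shift-≥ q C _ ⟩
      C (3 * w + (2 + j))       ≡⟨ period₃-periodic _ _ _ w (2 + j) ⟩
      C (2 + j)                 ∎
      where
      index : ∀ w j → (2 + 3 * w) + (2 + 3 * w) + j ≡ (2 + 3 * w) + (3 * w + (2 + j))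
      index = ℕ-Solver.solve-∀

  Φ-3q : ∀ w → let q = 2 + 3 * w in Prime q → 3 < q → coeff (Φ (3 * q)) ≗ Φ3q-series q
  Φ-3q w q-prime 3<q = Φ-unique _ (properDivisors-pq prime-3 q-prime 3<q) ∏₀≡1 (Φ3q-series q) identity degree
    where
    q = 2 + 3 * w
    ∏₀≡1 : ∏ˢ (3 ∷ q ∷ []) 0 ≡ + 1
    ∏₀≡1 = ∏ˢ-constant (3 ∷ q ∷ []) (Φ-prime prime-3 0 ∷ Φ-prime q-prime 0 ∷ [])
    identity : (1-x^ 1) *ˢ ∏ˢ (3 ∷ q ∷ []) *ˢ Φ3q-series q ≈[ suc (3 * q) ] 1-x^ (3 * q)
    identity = let open Truncated (suc (3 * q)) in begin
      (1-x^ 1) *ˢ ∏ˢ (3 ∷ q ∷ []) *ˢ Φ3q-series q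
        ≈⟨ ∙-congʳ (∙-congˡ (∙-cong (≗⇒≈ (Φ-prime prime-3)) (∙-congʳ (≗⇒≈ (Φ-prime q-prime))))) ⟩
      (1-x^ 1) *ˢ (ones 3 *ˢ (ones q *ˢ 1ˢ)) *ˢ Φ3q-series q
        ≈⟨ solve 4 (λ u₁ o₃ o_q t → u₁ ⊙ (o₃ ⊙ (o_q ⊙ id)) ⊙ t ⊜ u₁ ⊙ o₃ ⊙ o_q ⊙ t) ≈-refl
             (1-x^ 1) (ones 3) (ones q) (Φ3q-series q) ⟩
      (1-x^ 1) *ˢ ones 3 *ˢ ones q *ˢ Φ3q-series q
        ≈⟨ ≗⇒≈ (Φ3q-series-identity q) ⟩
      1-x^ (3 * q) ∎
    degree : ∀ k → 3 * q < k → Φ3q-series q k ≡ + 0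
    degree k 3q<k = Φ3q-series-degree w k (begin
      q + q         ≤⟨ ℕ.m≤m+n (q + q) q ⟩
      q + q + q     ≡⟨ thrice w ⟩
      3 * q         ≤⟨ ℕ.<⇒≤ 3q<k ⟩
      k             ∎)
      where
      open ℕ.≤-Reasoning
      thrice : ∀ w → (2 + 3 * w) + (2 + 3 * w) + (2 + 3 * w) ≡ 3 * (2 + 3 * w)
      thrice = ℕ-Solver.solve-∀

  Φ-pq-constant : ∀ {p q} → Prime p → Prime q → p < q → coeff (Φ (p * q)) 0 ≡ + 1
  Φ-pq-constant {zero}  p-prime _ _ = ⊥-elim (¬prime[0] p-prime)
  Φ-pq-constant {suc _} {zero} _ q-prime _ = ⊥-elim (¬prime[0] q-prime)
  Φ-pq-constant {suc _} {suc _} p-prime q-prime p<q =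
    trans (sym (ℤ.*-identityˡ _)) (Φ-pq-identity p-prime q-prime p<q 0 (s≤s z≤n))

  Φ-3pq-identity : ∀ w₂ w₃ → let p = 2 + 3 * w₂; q = 2 + 3 * w₃ in
    Prime p → Prime q → 3 < p → 3 * p < q →
    (1-x^ 1) *ˢ ones 3 *ˢ ones p *ˢ Φ3q-series p *ˢ ones q *ˢ Φ3q-series q *ˢ coeff (Φ (p * q))
      *ˢ coeff (Φ (3 * p * q)) ≈[ p * q ] 1ˢ
  Φ-3pq-identity w₂ w₃ p-prime q-prime 3<p 3p<q = begin
    (1-x^ 1) *ˢ ones 3 *ˢ ones p *ˢ Φ3q-series p *ˢ ones q *ˢ Φ3q-series q *ˢ coeff (Φ (p * q)) *ˢ s
      ≈⟨ solve 8 (λ u₁ o₃ oₚ tₚ o_q t_q w s → u₁ ⊙ o₃ ⊙ oₚ ⊙ tₚ ⊙ o_q ⊙ t_q ⊙ w ⊙ s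
                   ⊜ u₁ ⊙ (o₃ ⊙ (oₚ ⊙ (tₚ ⊙ (o_q ⊙ (t_q ⊙ (w ⊙ id)))))) ⊙ s) ≈-refl
           (1-x^ 1) (ones 3) (ones p) (Φ3q-series p) (ones q) (Φ3q-series q) (coeff (Φ (p * q))) s ⟩
    (1-x^ 1) *ˢ (ones 3 *ˢ (ones p *ˢ (Φ3q-series p *ˢ (ones q *ˢ (Φ3q-series q *ˢ (coeff (Φ (p * q)) *ˢ 1ˢ))))))
      *ˢ s
      ≈⟨ ∙-congʳ (∙-congˡ (∙-cong (explicit (Φ-prime prime-3)) (∙-cong (explicit (Φ-prime p-prime))
           (∙-cong (explicit (Φ-3q w₂ p-prime 3<p)) (∙-cong (explicit (Φ-prime q-prime))
             (∙-congʳ (explicit (Φ-3q w₃ q-prime 3<q)))))))) ⟩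
    (1-x^ 1) *ˢ ∏ˢ (3 ∷ p ∷ 3 * p ∷ q ∷ 3 * q ∷ p * q ∷ []) *ˢ s
      ≈⟨ ≈-weaken (ℕ.<⇒≤ pq<n+1) (Φ-identity _ (properDivisors-3pq p-prime q-prime 3<p 3p<q) ∏₀≡1) ⟩
    1-x^ (3 * p * q)
      ≈⟨ (λ k k<pq → 1-x^-< (3 * p * q) k (ℕ.<-trans k<pq pq<n)) ⟩
    1ˢ ∎
    where
    p = 2 + 3 * w₂
    q = 2 + 3 * w₃
    open Truncated (p * q)
    s = coeff (Φ (3 * p * q))
    explicit : ∀ {f g} → f ≗ g → g ≈[ p * q ] f
    explicit f≗g k _ = sym (f≗g k)
    3<q : 3 < q
    3<q = ℕ.<-trans 3<p (ℕ.<-trans (ℕ.m<m+n p (s≤s z≤n)) 3p<q)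
    pq<n : p * q < 3 * p * q
    pq<n = ℕ.*-monoˡ-< q (ℕ.m<m+n p (s≤s z≤n))
    pq<n+1 : p * q < suc (3 * p * q)
    pq<n+1 = ℕ.<-trans pq<n (ℕ.n<1+n _)
    ∏₀≡1 : ∏ˢ (3 ∷ p ∷ 3 * p ∷ q ∷ 3 * q ∷ p * q ∷ []) 0 ≡ + 1
    ∏₀≡1 = ∏ˢ-constant (3 ∷ p ∷ 3 * p ∷ q ∷ 3 * q ∷ p * q ∷ [])
      (Φ-prime prime-3 0 ∷ Φ-prime p-prime 0 ∷ Φ-3q w₂ p-prime 3<p 0 ∷ Φ-prime q-prime 0 ∷ Φ-3q w₃ q-prime 3<q 0
        ∷ Φ-pq-constant p-prime q-prime (ℕ.<-trans (ℕ.m<m+n p (s≤s z≤n)) 3p<q) ∷ [])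

module KeyRelation where

  open import Data.Nat using (_+_; _*_; _≤_; _<_; z≤n; s≤s; NonZero; _%_; _∸_)
  import Data.Nat.Properties as ℕ
  open import Data.Nat.DivMod using (m<n⇒m%n≡m; [m+n]%n≡m%n)
  open import Data.Integer using (+_; -_) renaming (_+_ to _+ℤ_)
  import Data.Integer.Properties as ℤ
  open import Data.Nat.Primality using (Prime)
  open import Relation.Nullary using (yes; no)
  open import Relation.Binary.PropositionalEquality
  open import Defs
  open PowerSeries
  open PolynomialSeries
  open ExplicitCyclotomic

  periodic : (m : ℕ) .{{_ : NonZero m}} → Series → Series
  periodic m g k = g (k % m)

  periodic-identity : ∀ m .{{_ : NonZero m}} g → (∀ j → g (m + j) ≡ + 0) → (1-x^ m) *ˢ periodic m g ≗ g
  periodic-identity m g g-support k with k ℕ.<? m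
  ... | yes k<m = begin
    ((1-x^ m) *ˢ periodic m g) k            ≡⟨ 1-x^-*ˢ m (periodic m g) k ⟩
    g (k % m) +ℤ - shift m (periodic m g) k
      ≡⟨ cong₂ (λ a b → g a +ℤ - b) (m<n⇒m%n≡m k<m) (shift-< m _ k k<m) ⟩
    g k +ℤ - + 0                            ≡⟨ ℤ.+-identityʳ (g k) ⟩
    g k                                     ∎
    where open ≡-Reasoning
  ... | no k≮m = begin
    ((1-x^ m) *ˢ periodic m g) k                    ≡⟨ 1-x^-*ˢ m (periodic m g) k ⟩
    g (k % m) +ℤ - shift m (periodic m g) k
      ≡⟨ cong (λ k → g (k % m) +ℤ - shift m (periodic m g) k) (sym m+j≡k) ⟩
    g ((m + j) % m) +ℤ - shift m (periodic m g) (m + j)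
      ≡⟨ cong₂ (λ a b → g a +ℤ - b) (trans (cong (_% m) (ℕ.+-comm m j)) ([m+n]%n≡m%n j m))
               (shift-≥ m (periodic m g) j) ⟩
    g (j % m) +ℤ - g (j % m)                        ≡⟨ ℤ.+-inverseʳ (g (j % m)) ⟩
    + 0                                             ≡⟨ sym (g-support j) ⟩
    g (m + j)                                       ≡⟨ cong g m+j≡k ⟩
    g k                                             ∎
    where
    open ≡-Reasoning
    j = k ∸ m
    m+j≡k : m + j ≡ k
    m+j≡k = ℕ.m+[n∸m]≡n (ℕ.≮⇒≥ k≮m)

  key-relation : ∀ w₂ w₃ → let p = 2 + 3 * w₂; q = 2 + 3 * w₃ in
    Prime p → Prime q → 3 < p → 3 * p < q →
    (1-x^ (3 * q)) *ˢ coeff (Φ (3 * p * q)) ≈[ p * q ] (1-x^ q) *ˢ periodic (3 * p) (ones 3 *ˢ 1-x^ p)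
  key-relation w₂ w₃ p-prime q-prime 3<p 3p<q =
    *ˢ-cancelˡ {f = (1-x^ 1) *ˢ ones 3 *ˢ ones p} refl
      (eliminate (≗⇒≈ (ones-identity p)) (≗⇒≈ (ones-identity q)) (≗⇒≈ (Φ3q-series-identity p))
        (≗⇒≈ (Φ3q-series-identity q)) (Φ-pq-identity p-prime q-prime p<q)
        (≗⇒≈ (periodic-identity (3 * p) G G-support)) (Φ-3pq-identity w₂ w₃ p-prime q-prime 3<p 3p<q))
    where
    p = 2 + 3 * w₂
    q = 2 + 3 * w₃
    open Elimination (*ˢ-commutativeMonoid (p * q))
    p<q : p < q
    p<q = ℕ.<-trans (ℕ.m<m+n p (s≤s z≤n)) 3p<q
    G = ones 3 *ˢ 1-x^ p
    G-support : ∀ j → G (3 * p + j) ≡ + 0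
    G-support j = begin
      G (3 * p + j)                                         ≡⟨ *ˢ-comm (ones 3) (1-x^ p) (3 * p + j) ⟩
      ((1-x^ p) *ˢ ones 3) (3 * p + j)                      ≡⟨ 1-x^-*ˢ p (ones 3) (3 * p + j) ⟩
      ones 3 (3 * p + j) +ℤ - shift p (ones 3) (3 * p + j)
        ≡⟨ cong₂ (λ a b → a +ℤ - b) (ones-beyond 3 _ 3≤3p+j) shifted ⟩
      + 0 +ℤ - + 0                                          ≡⟨⟩
      + 0                                                   ∎
      where
      open ≡-Reasoning
      3≤3p+j : 3 ≤ 3 * p + j
      3≤3p+j = ℕ.≤-trans (ℕ.<⇒≤ (ℕ.<-≤-trans 3<p (ℕ.m≤m+n p _))) (ℕ.m≤m+n (3 * p) j)
      shifted : shift p (ones 3) (3 * p + j) ≡ + 0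
      shifted = trans (cong (shift p (ones 3)) (ℕ.+-assoc p _ j))
                      (trans (shift-≥ p (ones 3) _)
                             (ones-beyond 3 _ (ℕ.≤-trans (ℕ.≤-trans (ℕ.<⇒≤ 3<p) (ℕ.m≤m+n p (p + 0))) (ℕ.m≤m+n _ j))))

module Strides where

  open import Data.Nat using (zero; suc; _+_; _*_; _<_; z≤n; s≤s; NonZero; _%_)
  import Data.Nat.Properties as ℕ
  open import Data.Nat.DivMod using (m<n⇒m%n≡m; [m+kn]%n≡m%n)
  import Data.Nat.Tactic.RingSolver as ℕ-Solver
  open import Data.Integer using (-_) renaming (_+_ to _+ℤ_)
  open import Relation.Binary.PropositionalEquality
  open PowerSeries
  open KeyRelation

  stride : ℕ → ℕ → Series → Series
  stride q c f a = f (a * q + c)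

  stride-shift₁ : ∀ {q c} f → c < q → stride q c (shift q f) ≗ shift 1 (stride q c f)
  stride-shift₁ {q} f c<q zero    = shift-< q f _ c<q
  stride-shift₁ {q} {c} f c<q (suc a) =
    trans (cong (shift q f) (ℕ.+-assoc q (a * q) c)) (shift-≥ q f (a * q + c))

  stride-shift : ∀ {q c} t f → c < q → stride q c (shift (t * q) f) ≗ shift t (stride q c f)
  stride-shift zero    f c<q a = refl
  stride-shift {q} {c} (suc t) f c<q a = begin
    shift (q + t * q) f (a * q + c)                ≡⟨ sym (shift-+ q (t * q) f _) ⟩
    stride q c (shift q (shift (t * q) f)) a       ≡⟨ stride-shift₁ (shift (t * q) f) c<q a ⟩
    shift 1 (stride q c (shift (t * q) f)) a       ≡⟨ shift-cong 1 (stride-shift t f c<q) a ⟩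
    shift 1 (shift t (stride q c f)) a             ≡⟨ shift-+ 1 t _ a ⟩
    shift (suc t) (stride q c f) a                 ∎
    where open ≡-Reasoning

  stride-1-x^ : ∀ {q c} t f → c < q → stride q c ((1-x^ (t * q)) *ˢ f) ≗ (1-x^ t) *ˢ stride q c f
  stride-1-x^ {q} {c} t f c<q a =
    trans (1-x^-*ˢ (t * q) f (a * q + c))
          (trans (cong (λ z → f (a * q + c) +ℤ - z) (stride-shift t f c<q a)) (sym (1-x^-*ˢ t (stride q c f) a)))

  stride-periodic : ∀ {q m qq r} .{{_ : NonZero m}} g a → q ≡ qq * m + 2 → a * 2 + r < m →
    stride q (qq * m + r) (periodic m g) a ≡ stride 2 r g a
  stride-periodic {q} {m} {qq} {r} g a q≡ 2a+r<m = cong g (begin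
    (a * q + (qq * m + r)) % m                ≡⟨ cong (λ q → (a * q + (qq * m + r)) % m) q≡ ⟩
    (a * (qq * m + 2) + (qq * m + r)) % m     ≡⟨ cong (_% m) (regroup a qq m r) ⟩
    (a * 2 + r + (a * qq + qq) * m) % m       ≡⟨ [m+kn]%n≡m%n (a * 2 + r) (a * qq + qq) m ⟩
    (a * 2 + r) % m                           ≡⟨ m<n⇒m%n≡m 2a+r<m ⟩
    a * 2 + r                                 ∎)
    where
    open ≡-Reasoning
    regroup : ∀ a qq m r → a * (qq * m + 2) + (qq * m + r) ≡ a * 2 + r + (a * qq + qq) * m
    regroup = ℕ-Solver.solve-∀

  stride₀-shift₁ : ∀ f → stride 2 0 (shift 1 f) ≗ shift 1 (stride 2 1 f)
  stride₀-shift₁ f zero    = refl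
  stride₀-shift₁ f (suc a) = cong f (sym (ℕ.+-suc (a * 2) 0))

  stride₁-shift₁ : ∀ f → stride 2 1 (shift 1 f) ≗ stride 2 0 f
  stride₁-shift₁ f a rewrite ℕ.+-suc (a * 2) 0 = refl

  stride₀-shift-odd : ∀ e f → stride 2 0 (shift (e * 2 + 1) f) ≗ shift (suc e) (stride 2 1 f)
  stride₀-shift-odd e f a = begin
    shift (e * 2 + 1) f (a * 2 + 0)            ≡⟨ sym (shift-+ (e * 2) 1 f _) ⟩
    stride 2 0 (shift (e * 2) (shift 1 f)) a   ≡⟨ stride-shift e (shift 1 f) (s≤s z≤n) a ⟩
    shift e (stride 2 0 (shift 1 f)) a         ≡⟨ shift-cong e (stride₀-shift₁ f) a ⟩
    shift e (shift 1 (stride 2 1 f)) a         ≡⟨ shift-+ e 1 _ a ⟩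
    shift (e + 1) (stride 2 1 f) a             ≡⟨ cong (λ n → shift n (stride 2 1 f) a) (ℕ.+-comm e 1) ⟩
    shift (suc e) (stride 2 1 f) a             ∎
    where open ≡-Reasoning

  stride₁-shift-odd : ∀ e f → stride 2 1 (shift (e * 2 + 1) f) ≗ shift e (stride 2 0 f)
  stride₁-shift-odd e f a = begin
    shift (e * 2 + 1) f (a * 2 + 1)            ≡⟨ sym (shift-+ (e * 2) 1 f _) ⟩
    stride 2 1 (shift (e * 2) (shift 1 f)) a   ≡⟨ stride-shift e (shift 1 f) (s≤s (s≤s z≤n)) a ⟩
    shift e (stride 2 1 (shift 1 f)) a         ≡⟨ shift-cong e (stride₁-shift₁ f) a ⟩
    shift e (stride 2 0 f) a                   ∎
    where open ≡-Reasoning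

module Decimation where

  open import Data.Nat using (zero; suc; _+_; _*_; z≤n; s≤s)
  import Data.Nat.Properties as ℕ
  open import Data.Integer using (+_; -_) renaming (_+_ to _+ℤ_)
  open import Relation.Binary.PropositionalEquality
  open PowerSeries
  open ExplicitCyclotomic
  open Strides

  ones₁≗1ˢ : ones 1 ≗ 1ˢ
  ones₁≗1ˢ zero    = refl
  ones₁≗1ˢ (suc k) = refl

  [1-x]/[1-x³]*ones₂ : [1-x]/[1-x³] *ˢ ones 2 ≗ [1-x²]/[1-x³]
  [1-x]/[1-x³]*ones₂ = ≈⇒≗ λ L → *ˢ-cancelˡ {L} {1-x^ 3} refl (≗⇒≈ λ k → begin
    ((1-x^ 3) *ˢ ([1-x]/[1-x³] *ˢ ones 2)) k   ≡⟨ sym (*ˢ-assoc (1-x^ 3) [1-x]/[1-x³] (ones 2) k) ⟩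
    ((1-x^ 3) *ˢ [1-x]/[1-x³] *ˢ ones 2) k     ≡⟨ *ˢ-congˡ (ones 2) [1-x]/[1-x³]-identity k ⟩
    ((1-x^ 1) *ˢ ones 2) k                     ≡⟨ ones-identity 2 k ⟩
    (1-x^ 2) k                                 ≡⟨ sym ([1-x²]/[1-x³]-identity k) ⟩
    ((1-x^ 3) *ˢ [1-x²]/[1-x³]) k              ∎)
    where open ≡-Reasoning

  stride₀-ones₃ : stride 2 0 (ones 3) ≗ ones 2
  stride₀-ones₃ zero          = refl
  stride₀-ones₃ (suc zero)    = refl
  stride₀-ones₃ (suc (suc a)) = ones-beyond 3 (suc (suc a) * 2 + 0) (s≤s (s≤s (s≤s z≤n)))

  stride₁-ones₃ : stride 2 1 (ones 3) ≗ ones 1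
  stride₁-ones₃ zero    = refl
  stride₁-ones₃ (suc a) = ones-beyond 1 (a * 2 + 1) (ℕ.m≤n+m 1 (a * 2))

  ones₃-1-x^ : ∀ n → ones 3 *ˢ 1-x^ n ≗ ones 3 +ˢ -ˢ shift n (ones 3)
  ones₃-1-x^ n k = trans (*ˢ-comm (ones 3) (1-x^ n) k) (1-x^-*ˢ n (ones 3) k)

  stride₀-ones₃-1-x^-odd : ∀ e → stride 2 0 (ones 3 *ˢ 1-x^ (e * 2 + 1)) ≗ ones 2 +ˢ -ˢ shift (suc e) (ones 1)
  stride₀-ones₃-1-x^-odd e a =
    trans (ones₃-1-x^ (e * 2 + 1) (a * 2 + 0))
          (cong₂ (λ x y → x +ℤ - y) (stride₀-ones₃ a)
                 (trans (stride₀-shift-odd e (ones 3) a) (shift-cong (suc e) stride₁-ones₃ a)))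

  stride₁-ones₃-1-x^-odd : ∀ e → stride 2 1 (ones 3 *ˢ 1-x^ (e * 2 + 1)) ≗ ones 1 +ˢ -ˢ shift e (ones 2)
  stride₁-ones₃-1-x^-odd e a =
    trans (ones₃-1-x^ (e * 2 + 1) (a * 2 + 1))
          (cong₂ (λ x y → x +ℤ - y) (stride₁-ones₃ a)
                 (trans (stride₁-shift-odd e (ones 3) a) (shift-cong e stride₀-ones₃ a)))

module HammingWeight where

  open import Data.Nat using (zero; suc; _+_; _≤_; _<_; z≤n; s≤s)
  import Data.Nat.Properties as ℕ
  open import Data.Integer as ℤ using (ℤ; +_)
  open import Data.List using ([]; _∷_; map; applyUpTo)
  open import Function using (_∘_)
  open import Relation.Nullary using (yes; no)
  open import Relation.Binary.PropositionalEquality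
  open import Defs

  hw₁ : ℤ → ℕ
  hw₁ a = hw (a ∷ [])

  hw-∷ : ∀ a f → hw (a ∷ f) ≡ hw₁ a + hw f
  hw-∷ a f with a ℤ.≟ + 0
  ... | yes _ = refl
  ... | no  _ = refl

  hw-zeros : ∀ f → (∀ k → coeff f k ≡ + 0) → hw f ≡ 0
  hw-zeros []      _      = refl
  hw-zeros (a ∷ f) f≡0 rewrite f≡0 0 = hw-zeros f (f≡0 ∘ suc)

  hw-two : ∀ f → (∀ k → 2 ≤ k → coeff f k ≡ + 0) → hw f ≡ hw₁ (coeff f 0) + hw₁ (coeff f 1)
  hw-two []          _      = refl
  hw-two (a ∷ [])    _      = sym (ℕ.+-identityʳ (hw₁ a))
  hw-two (a ∷ b ∷ f) tail≡0 = begin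
    hw (a ∷ b ∷ f)          ≡⟨ hw-∷ a (b ∷ f) ⟩
    hw₁ a + hw (b ∷ f)      ≡⟨ cong (_+_ (hw₁ a)) (hw-∷ b f) ⟩
    hw₁ a + (hw₁ b + hw f)  ≡⟨ cong (λ n → hw₁ a + (hw₁ b + n)) (hw-zeros f (λ k → tail≡0 (2 + k) (s≤s (s≤s z≤n)))) ⟩
    hw₁ a + (hw₁ b + 0)     ≡⟨ cong (_+_ (hw₁ a)) (ℕ.+-identityʳ (hw₁ b)) ⟩
    hw₁ a + hw₁ b           ∎
    where open ≡-Reasoning

  coeff-map-applyUpTo : ∀ (g : ℕ → ℤ) f L k → k < L → coeff (map g (applyUpTo f L)) k ≡ g (f k)
  coeff-map-applyUpTo g f (suc L) zero    _         = refl
  coeff-map-applyUpTo g f (suc L) (suc k) (s≤s k<L) = coeff-map-applyUpTo g (f ∘ suc) L k k<L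

  coeff-map-applyUpTo-≥ : ∀ (g : ℕ → ℤ) f L k → L ≤ k → coeff (map g (applyUpTo f L)) k ≡ + 0
  coeff-map-applyUpTo-≥ g f zero    k       _         = refl
  coeff-map-applyUpTo-≥ g f (suc L) (suc k) (s≤s L≤k) = coeff-map-applyUpTo-≥ g (f ∘ suc) L k L≤k

  coeff-block-< : ∀ f s L k → k < L → coeff (block f s L) k ≡ coeff f (s + k)
  coeff-block-< f s = coeff-map-applyUpTo (λ k → coeff f (s + k)) (λ k → k)

  coeff-block-≥ : ∀ f s L k → L ≤ k → coeff (block f s L) k ≡ + 0
  coeff-block-≥ f s = coeff-map-applyUpTo-≥ (λ k → coeff f (s + k)) (λ k → k)

module Rows (w : ℕ) {q qq : ℕ} where

  open import Data.Nat using (suc; _+_; _*_; _∸_; _≤_; _<_; z≤n; s≤s)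
  import Data.Nat.Properties as ℕ
  import Data.Nat.Tactic.RingSolver as ℕ-Solver
  open import Data.Nat.Primality using (Prime)
  open import Data.Integer using (+_; -_; -[1+_]) renaming (_+_ to _+ℤ_)
  open import Data.Product using (_×_; _,_; proj₁; proj₂)
  open import Relation.Nullary using (yes; no)
  open import Relation.Binary.PropositionalEquality hiding ([_])
  open import Defs
  open PowerSeries
  open ExplicitCyclotomic
  open KeyRelation
  open Strides
  open Decimation
  open HammingWeight

  p m : ℕ
  p = 2 + 3 * (1 + 2 * w)
  m = 3 * p

  -- row r a is the coefficient of xʳ in f_{3p,q,a,qq} (see hw-f₄).
  row : ℕ → Series
  row r = stride q (qq * m + r) (coeff (Φ (3 * p * q)))

  scaled-< : ∀ {u t v} e → u ≤ t → v < e → 3 * u + v < e + 3 * t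
  scaled-< {u} {t} {v} e u≤t v<e =
    ℕ.<-≤-trans (ℕ.+-monoʳ-< (3 * u) v<e)
                (ℕ.≤-trans (ℕ.+-monoˡ-≤ e (ℕ.*-monoʳ-≤ 3 u≤t)) (ℕ.≤-reflexive (ℕ.+-comm (3 * t) e)))

  shifted-index : ∀ {t u} e k v → t ≤ u → e + k ≡ 3 * t + v → e + (3 * (u ∸ t) + k) ≡ 3 * u + v
  shifted-index {t} {u} e k v t≤u e+k≡ = begin
    e + (3 * (u ∸ t) + k)       ≡⟨ swap e (u ∸ t) k ⟩
    e + k + 3 * (u ∸ t)         ≡⟨ cong (_+ 3 * (u ∸ t)) e+k≡ ⟩
    3 * t + v + 3 * (u ∸ t)     ≡⟨ gather t (u ∸ t) v ⟩
    3 * (t + (u ∸ t)) + v       ≡⟨ cong (λ n → 3 * n + v) (ℕ.m+[n∸m]≡n t≤u) ⟩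
    3 * u + v                   ∎
    where
    open ≡-Reasoning
    swap : ∀ e d k → e + (3 * d + k) ≡ e + k + 3 * d
    swap = ℕ-Solver.solve-∀
    gather : ∀ t d v → 3 * t + v + 3 * d ≡ 3 * (t + d) + v
    gather = ℕ-Solver.solve-∀

  double-index<m : ∀ {j r} → r ≤ 1 → j < p → j * 2 + r < m
  double-index<m {j} r≤1 j<p = ℕ.<-≤-trans (ℕ.+-monoʳ-< (j * 2) (s≤s r≤1)) (begin
    j * 2 + 2   ≡⟨ ℕ.+-comm (j * 2) 2 ⟩
    suc j * 2   ≤⟨ ℕ.*-monoˡ-≤ 2 j<p ⟩
    p * 2       ≤⟨ ℕ.*-monoʳ-≤ p {2} {3} (s≤s (s≤s z≤n)) ⟩
    p * 3       ≡⟨ ℕ.*-comm p 3 ⟩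
    3 * p       ∎)
    where open ℕ.≤-Reasoning

  3<p : 3 < p
  3<p = s≤s (s≤s (s≤s (ℕ.≤-trans (s≤s z≤n) (ℕ.m≤n+m _ (2 * w)))))

  module _ (p-prime : Prime p) (q-prime : Prime q) (3p<q : 3 * p < q) (q≡ : q ≡ qq * m + 2) where

    offset<q : ∀ {r} → r ≤ 1 → qq * m + r < q
    offset<q {r} r≤1 = subst (qq * m + r <_) (sym q≡) (ℕ.+-monoʳ-< (qq * m) (s≤s r≤1))

    key-relation-q : (1-x^ (3 * q)) *ˢ coeff (Φ (3 * p * q)) ≈[ p * q ] (1-x^ q) *ˢ periodic m (ones 3 *ˢ 1-x^ p)
    key-relation-q = at-shape q (trans q≡ (shape qq p)) q-prime 3p<q
      where
      shape : ∀ qq p → qq * (3 * p) + 2 ≡ 2 + 3 * (qq * p)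
      shape = ℕ-Solver.solve-∀
      at-shape : ∀ q′ → q′ ≡ 2 + 3 * (qq * p) → Prime q′ → 3 * p < q′ →
        (1-x^ (3 * q′)) *ˢ coeff (Φ (3 * p * q′)) ≈[ p * q′ ] (1-x^ q′) *ˢ periodic m (ones 3 *ˢ 1-x^ p)
      at-shape _ refl q′-prime 3p<q′ = key-relation (1 + 2 * w) (qq * p) p-prime q′-prime 3<p 3p<q′

    row-identity : ∀ {r} → r ≤ 1 → (1-x^ 3) *ˢ row r ≈[ p ] (1-x^ 1) *ˢ stride 2 r (ones 3 *ˢ 1-x^ p)
    row-identity {r} r≤1 a a<p = begin
      ((1-x^ 3) *ˢ row r) a
        ≡⟨ sym (stride-1-x^ 3 s c<q a) ⟩
      ((1-x^ (3 * q)) *ˢ s) (a * q + c)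
        ≡⟨ key-relation-q (a * q + c) index<pq ⟩
      ((1-x^ q) *ˢ H) (a * q + c)
        ≡⟨ *ˢ-congˡ H (λ k → cong (λ n → (1-x^ n) k) (sym (ℕ.*-identityˡ q))) (a * q + c) ⟩
      ((1-x^ (1 * q)) *ˢ H) (a * q + c)
        ≡⟨ stride-1-x^ 1 H c<q a ⟩
      ((1-x^ 1) *ˢ stride q c H) a
        ≡⟨ *ˢ-cong {p} (λ _ _ → refl) (λ j j<p → stride-periodic {q} {m} {qq} {r} G j q≡ (double-index<m r≤1 j<p))
                   a a<p ⟩
      ((1-x^ 1) *ˢ stride 2 r G) a ∎
      where
      open ≡-Reasoning
      s = coeff (Φ (3 * p * q))
      c = qq * m + r
      G = ones 3 *ˢ 1-x^ p
      H = periodic m G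
      c<q = offset<q r≤1
      index<pq : a * q + c < p * q
      index<pq = ℕ.<-≤-trans (ℕ.+-monoʳ-< (a * q) c<q)
        (ℕ.≤-trans (ℕ.≤-reflexive (ℕ.+-comm (a * q) q)) (ℕ.*-monoˡ-≤ q a<p))

    row-series : ∀ {r} → r ≤ 1 → row r ≈[ p ] [1-x]/[1-x³] *ˢ stride 2 r (ones 3 *ˢ 1-x^ p)
    row-series {r} r≤1 = *ˢ-cancelˡ {f = 1-x^ 3} refl λ a a<p →
      trans (row-identity r≤1 a a<p)
            (sym (trans (sym (*ˢ-assoc (1-x^ 3) [1-x]/[1-x³] Γ a)) (*ˢ-congˡ Γ [1-x]/[1-x³]-identity a)))
      where Γ = stride 2 r (ones 3 *ˢ 1-x^ p)

    p-odd : ∀ k → (1-x^ p) k ≡ (1-x^ ((2 + 3 * w) * 2 + 1)) k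
    p-odd k = cong (λ n → (1-x^ n) k) (odd w)
      where
      odd : ∀ w → 2 + 3 * (1 + 2 * w) ≡ (2 + 3 * w) * 2 + 1
      odd = ℕ-Solver.solve-∀

    row₀-explicit : row 0 ≈[ p ] [1-x²]/[1-x³] +ˢ -ˢ shift (3 + 3 * w) [1-x]/[1-x³]
    row₀-explicit a a<p = begin
      row 0 a
        ≡⟨ row-series z≤n a a<p ⟩
      (C *ˢ stride 2 0 (ones 3 *ˢ 1-x^ p)) a
        ≡⟨ *ˢ-congʳ C (λ b → trans (*ˢ-congʳ (ones 3) p-odd (b * 2 + 0))
                                   (stride₀-ones₃-1-x^-odd (2 + 3 * w) b)) a ⟩
      (C *ˢ (ones 2 +ˢ -ˢ shift (3 + 3 * w) (ones 1))) a
        ≡⟨ *ˢ-difference C (ones 2) _ a ⟩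
      (C *ˢ ones 2) a +ℤ - (C *ˢ shift (3 + 3 * w) (ones 1)) a
        ≡⟨ cong₂ (λ x y → x +ℤ - y) ([1-x]/[1-x³]*ones₂ a)
                 (trans (*ˢ-shift (3 + 3 * w) C (ones 1) a)
                        (shift-cong (3 + 3 * w) (λ k → trans (*ˢ-congʳ C ones₁≗1ˢ k) (*ˢ-identityʳ C k)) a)) ⟩
      [1-x²]/[1-x³] a +ℤ - shift (3 + 3 * w) C a ∎
      where
      open ≡-Reasoning
      C = [1-x]/[1-x³]

    row₁-explicit : row 1 ≈[ p ] [1-x]/[1-x³] +ˢ -ˢ shift (2 + 3 * w) [1-x²]/[1-x³]
    row₁-explicit a a<p = begin
      row 1 a
        ≡⟨ row-series (s≤s z≤n) a a<p ⟩
      (C *ˢ stride 2 1 (ones 3 *ˢ 1-x^ p)) a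
        ≡⟨ *ˢ-congʳ C (λ b → trans (*ˢ-congʳ (ones 3) p-odd (b * 2 + 1))
                                   (stride₁-ones₃-1-x^-odd (2 + 3 * w) b)) a ⟩
      (C *ˢ (ones 1 +ˢ -ˢ shift (2 + 3 * w) (ones 2))) a
        ≡⟨ *ˢ-difference C (ones 1) _ a ⟩
      (C *ˢ ones 1) a +ℤ - (C *ˢ shift (2 + 3 * w) (ones 2)) a
        ≡⟨ cong₂ (λ x y → x +ℤ - y) (trans (*ˢ-congʳ C ones₁≗1ˢ a) (*ˢ-identityʳ C a))
                 (trans (*ˢ-shift (2 + 3 * w) C (ones 2) a) (shift-cong (2 + 3 * w) [1-x]/[1-x³]*ones₂ a)) ⟩
      C a +ℤ - shift (2 + 3 * w) [1-x²]/[1-x³] a ∎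
      where
      open ≡-Reasoning
      C = [1-x]/[1-x³]

    row₀-3u+1 : ∀ u → 3 * u + 1 < p →
      (u ≤ w → row 0 (3 * u + 1) ≡ + 0) × (w < u → row 0 (3 * u + 1) ≡ + 1)
    row₀-3u+1 u i<p =
      (λ u≤w → trans (row₀-explicit _ i<p) (period₃-minus-shift (3 + 3 * w) u 1
                 (shift-< (3 + 3 * w) _ _ (scaled-< 3 u≤w (s≤s (s≤s z≤n)))))) ,
      (λ w<u → trans (row₀-explicit _ i<p) (period₃-minus-shift (3 + 3 * w) u 1
                 (shift-period₃ (3 + 3 * w) (u ∸ suc w) 1 (shifted-index (3 + 3 * w) 1 1 w<u (edge w)))))
      where
      edge : ∀ w → 3 + 3 * w + 1 ≡ 3 * suc w + 1
      edge = ℕ-Solver.solve-∀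

    row₀-3u+2 : ∀ u → 3 * u + 2 < p → row 0 (3 * u + 2) ≡ -[1+ 0 ]
    row₀-3u+2 u i<p with u ℕ.≤? w
    ... | yes u≤w = trans (row₀-explicit _ i<p) (period₃-minus-shift (3 + 3 * w) u 2
                 (shift-< (3 + 3 * w) _ _ (scaled-< 3 u≤w (s≤s (s≤s (s≤s z≤n))))))
    ... | no  u≰w = trans (row₀-explicit _ i<p) (period₃-minus-shift (3 + 3 * w) u 2
                 (shift-period₃ (3 + 3 * w) (u ∸ suc w) 2 (shifted-index (3 + 3 * w) 2 2 (ℕ.≰⇒> u≰w) (edge w))))
      where
      edge : ∀ w → 3 + 3 * w + 2 ≡ 3 * suc w + 2
      edge = ℕ-Solver.solve-∀

    row₁-3u+1 : ∀ u → 3 * u + 1 < p →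
      (u ≤ w → row 1 (3 * u + 1) ≡ -[1+ 0 ]) × (w < u → row 1 (3 * u + 1) ≡ + 0)
    row₁-3u+1 u i<p =
      (λ u≤w → trans (row₁-explicit _ i<p) (period₃-minus-shift (2 + 3 * w) u 1
                 (shift-< (2 + 3 * w) _ _ (scaled-< 2 u≤w (s≤s (s≤s z≤n)))))) ,
      (λ w<u → trans (row₁-explicit _ i<p) (period₃-minus-shift (2 + 3 * w) u 1
                 (shift-period₃ (2 + 3 * w) (u ∸ suc w) 2 (shifted-index (2 + 3 * w) 2 1 w<u (edge w)))))
      where
      edge : ∀ w → 2 + 3 * w + 2 ≡ 3 * suc w + 1
      edge = ℕ-Solver.solve-∀

    row₁-3u+2 : ∀ u → 3 * u + 2 < p →
      (u < w → row 1 (3 * u + 2) ≡ + 0) × (w ≤ u → row 1 (3 * u + 2) ≡ -[1+ 0 ])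
    row₁-3u+2 u i<p =
      (λ u<w → trans (row₁-explicit _ i<p) (period₃-minus-shift (2 + 3 * w) u 2
                 (shift-< (2 + 3 * w) _ _ (below u<w)))) ,
      (λ w≤u → trans (row₁-explicit _ i<p) (period₃-minus-shift (2 + 3 * w) u 2
                 (shift-period₃ (2 + 3 * w) (u ∸ w) 0 (shifted-index (2 + 3 * w) 0 2 w≤u (edge w)))))
      where
      edge : ∀ w → 2 + 3 * w + 0 ≡ 3 * w + 2
      edge = ℕ-Solver.solve-∀
      below : u < w → 3 * u + 2 < 2 + 3 * w
      below u<w = begin-strict
        3 * u + 2       <⟨ ℕ.+-monoˡ-< 2 (ℕ.*-monoʳ-< 3 (ℕ.n<1+n u)) ⟩
        3 * suc u + 2   ≤⟨ ℕ.+-monoˡ-≤ 2 (ℕ.*-monoʳ-≤ 3 u<w) ⟩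
        3 * w + 2       ≡⟨ ℕ.+-comm (3 * w) 2 ⟩
        2 + 3 * w       ∎
        where open ℕ.≤-Reasoning

    hw-f₄ : ∀ a → hw (f₄ m q a qq) ≡ hw₁ (row 0 a) + hw₁ (row 1 a)
    hw-f₄ a = trans (hw-two (f₄ m q a qq) tail≡0) (cong₂ (λ x y → hw₁ x + hw₁ y) (entry z≤n) (entry (s≤s z≤n)))
      where
      F₃ = f₃ m q a
      entry : ∀ {r} → r ≤ 1 → coeff (f₄ m q a qq) r ≡ row r a
      entry {r} r≤1 = trans (coeff-block-< F₃ (qq * m) m r (ℕ.≤-<-trans r≤1 (s≤s (s≤s z≤n))))
                            (coeff-block-< (Φ (m * q)) (a * q) q (qq * m + r) (offset<q r≤1))
      tail≡0 : ∀ k → 2 ≤ k → coeff (f₄ m q a qq) k ≡ + 0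
      tail≡0 k 2≤k with k ℕ.<? m
      ... | yes k<m = trans (coeff-block-< F₃ (qq * m) m k k<m)
                            (coeff-block-≥ (Φ (m * q)) (a * q) q (qq * m + k)
                              (subst (_≤ qq * m + k) (sym q≡) (ℕ.+-monoʳ-≤ (qq * m) 2≤k)))
      ... | no  k≮m = coeff-block-≥ F₃ (qq * m) m k (ℕ.≮⇒≥ k≮m)

    hw-f₄-3u+1 : ∀ u → 3 * u + 1 < p → hw (f₄ m q (3 * u + 1) qq) ≡ 1
    hw-f₄-3u+1 u i<p with u ℕ.≤? w
    ... | yes u≤w = trans (hw-f₄ (3 * u + 1))
                          (cong₂ (λ x y → hw₁ x + hw₁ y) (proj₁ (row₀-3u+1 u i<p) u≤w) (proj₁ (row₁-3u+1 u i<p) u≤w))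
    ... | no  u≰w = trans (hw-f₄ (3 * u + 1))
                          (cong₂ (λ x y → hw₁ x + hw₁ y) (proj₂ (row₀-3u+1 u i<p) w<u) (proj₂ (row₁-3u+1 u i<p) w<u))
      where w<u = ℕ.≰⇒> u≰w

    hw-f₄-3u+2 : ∀ u → 3 * u + 2 < p →
      (u < w → hw (f₄ m q (3 * u + 2) qq) ≡ 1) × (w ≤ u → hw (f₄ m q (3 * u + 2) qq) ≡ 2)
    hw-f₄-3u+2 u i<p =
      (λ u<w → trans (hw-f₄ (3 * u + 2))
                     (cong₂ (λ x y → hw₁ x + hw₁ y) (row₀-3u+2 u i<p) (proj₁ (row₁-3u+2 u i<p) u<w))) ,
      (λ w≤u → trans (hw-f₄ (3 * u + 2))
                     (cong₂ (λ x y → hw₁ x + hw₁ y) (row₀-3u+2 u i<p) (proj₂ (row₁-3u+2 u i<p) w≤u)))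

open import Defs
open import Data.Nat using (ℕ; suc; _+_; _*_; _∸_; _<_; _≤_; _/_; _%_; z≤n; s≤s)
import Data.Nat.Properties as ℕ
import Data.Nat.Tactic.RingSolver as ℕ-Solver
open import Data.Nat.DivMod using (m≡m%n+[m/n]*n; m%n<n; m*n/n≡m)
open import Data.Nat.Divisibility using (divides)
open import Data.Nat.Primality using (Prime; prime⇒irreducible)
open import Data.Sum using (_⊎_; inj₁; inj₂)
open import Data.Product using (∃-syntax; _×_; _,_; proj₁; proj₂)
open import Data.Empty using (⊥-elim)
open import Relation.Binary.PropositionalEquality

prime-≡5-mod-6 : ∀ {p} → Prime p → 3 < p → p % 3 ≡ 2 → ∃[ w ] p ≡ 2 + 3 * (1 + 2 * w)
prime-≡5-mod-6 {p} p-prime 3<p p≡2 with (p / 3) % 2 | m%n<n (p / 3) 2 | m≡m%n+[m/n]*n (p / 3) 2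
... | 0 | _ | a≡ with prime⇒irreducible p-prime (divides (1 + 3 * (p / 3 / 2)) (trans p≡ (even (p / 3 / 2))))
  where
  p≡ : p ≡ 2 + (p / 3 / 2) * 2 * 3
  p≡ = trans (m≡m%n+[m/n]*n p 3) (cong₂ (λ r a → r + a * 3) p≡2 a≡)
  even : ∀ c → 2 + c * 2 * 3 ≡ (1 + 3 * c) * 2
  even = ℕ-Solver.solve-∀
...   | inj₁ ()
...   | inj₂ 2≡p = ⊥-elim (ℕ.<-asym 3<p (subst (_< 3) 2≡p (s≤s (s≤s (s≤s z≤n)))))
prime-≡5-mod-6 {p} _ _ p≡2 | 1 | _ | a≡ =
  p / 3 / 2 , trans (m≡m%n+[m/n]*n p 3) (trans (cong₂ (λ r a → r + a * 3) p≡2 a≡) (odd (p / 3 / 2)))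
  where
  odd : ∀ c → 2 + (1 + c * 2) * 3 ≡ 2 + 3 * (1 + 2 * c)
  odd = ℕ-Solver.solve-∀
prime-≡5-mod-6 _ _ _ | suc (suc _) | s≤s (s≤s ()) | _

halve-< : ∀ {u w} → 2 * u + 3 ≤ 1 + 2 * w → u < w
halve-< {u} {w} le = ℕ.*-cancelˡ-≤ 2 (ℕ.+-cancelˡ-≤ 1 (2 * suc u) (2 * w) (subst (_≤ 1 + 2 * w) (shape u) le))
  where
  shape : ∀ u → 2 * u + 3 ≡ 1 + 2 * suc u
  shape = ℕ-Solver.solve-∀

halve-≤ : ∀ {u w} → 1 + 2 * w ≤ 2 * u + 1 → w ≤ u
halve-≤ {u} {w} le =
  ℕ.*-cancelˡ-≤ 2 (ℕ.+-cancelˡ-≤ 1 (2 * w) (2 * u) (subst (1 + 2 * w ≤_) (ℕ.+-comm (2 * u) 1) le))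

lemma4p10 : (p₂ p₃ u v : ℕ) → Prime p₂ → 3 < p₂ → p₂ % 3 ≡ 2
    → Prime p₃ → 3 * p₂ < p₃ → modℕ p₃ (3 * p₂) ≡ 2
    → (v ≡ 1 ⊎ v ≡ 2) → 3 * u + v < p₂ ∸ 1
    → let q₂ = (p₂ ∸ 2) / 3
          q = divℕ p₃ (3 * p₂)
          i = 3 * u + v
      in (2 * u + 3 ≤ q₂ → hw (f₄ (3 * p₂) p₃ i q) ≡ 1)
         × (q₂ ≤ 2 * u + 1 → hw (f₄ (3 * p₂) p₃ i q) ≡ v)
lemma4p10 p₂ p₃ u v p₂-prime 3<p₂ p₂≡2 p₃-prime 3p₂<p₃ p₃≡2 v∈ i<p₂-1
  with prime-≡5-mod-6 p₂-prime 3<p₂ p₂≡2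
... | w , refl = weights v∈ i<p₂-1
  where
  open Rows w {p₃} {divℕ p₃ (3 * p₂)}
  q₂≡ : (p₂ ∸ 2) / 3 ≡ 1 + 2 * w
  q₂≡ = trans (cong (_/ 3) (ℕ.*-comm 3 (1 + 2 * w))) (m*n/n≡m (1 + 2 * w) 3)
  p₃≡ : p₃ ≡ divℕ p₃ m * m + 2
  p₃≡ = trans (m≡m%n+[m/n]*n p₃ m) (trans (cong (_+ p₃ / m * m) p₃≡2) (ℕ.+-comm 2 _))
  weights : ∀ {v} → v ≡ 1 ⊎ v ≡ 2 → 3 * u + v < p₂ ∸ 1 →
    (2 * u + 3 ≤ (p₂ ∸ 2) / 3 → hw (f₄ m p₃ (3 * u + v) (divℕ p₃ m)) ≡ 1) ×
    ((p₂ ∸ 2) / 3 ≤ 2 * u + 1 → hw (f₄ m p₃ (3 * u + v) (divℕ p₃ m)) ≡ v)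
  weights (inj₁ refl) i<p-1 = (λ _ → weight) , (λ _ → weight)
    where weight = hw-f₄-3u+1 p₂-prime p₃-prime 3p₂<p₃ p₃≡ u (ℕ.<-≤-trans i<p-1 (ℕ.m∸n≤m p₂ 1))
  weights (inj₂ refl) i<p-1 =
    (λ 2u+3≤q₂ → proj₁ weight (halve-< (subst (2 * u + 3 ≤_) q₂≡ 2u+3≤q₂))) ,
    (λ q₂≤2u+1 → proj₂ weight (halve-≤ (subst (_≤ 2 * u + 1) q₂≡ q₂≤2u+1)))
    where weight = hw-f₄-3u+2 p₂-prime p₃-prime 3p₂<p₃ p₃≡ u (ℕ.<-≤-trans i<p-1 (ℕ.m∸n≤m p₂ 1))
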